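{- Let $t\ge2$, $n\ge1$, and let $\lambda$ be a partition with $\ell(\lambda)\le tn$. Write $n_i=n_i(\lambda,tn)$. Then the $t$-core of $\lambda$ is an orthogonal $t$-core if and only if $n_0=n$ and $n_i+n_{t-i}=2n$ for all $1\le i\le\lfloor t/2\rfloor$.
   Context: For a partition $\lambda$ with $\ell(\lambda)\le m$, $\beta(\lambda,m)=(\lambda_j+m-j)_{j=1}^m$ and $n_i(\lambda,m)$ is the number of its entries congruent to $i$ mod $t$. The $t$-core of $\lambda$ is obtained by successively removing border strips of size $t$ until none can be removed. A partition is orthogonal if in Frobenius coordinates it is $(\alpha|\alpha-1)$, i.e. with rank $r$ (largest $r$ with $\lambda_r\ge r$), $\lambda'_i-i=\lambda_i-i-1$ for $1\le i\le r$ (empty partition included); an orthogonal $t$-core is an orthogonal partition that is a $t$-core. -}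

module Defs where

open import Data.Nat using (ℕ; zero; suc; _+_; _*_; _∸_; _≤_; _<_; _≤?_; _≟_; NonZero)
open import Data.Nat.DivMod using (_%_)
open import Data.List using (List; []; _∷_; length; filter; upTo; map)
open import Data.Nat.ListAction using (sum)
open import Data.List.Relation.Unary.All using (All)
open import Data.Product using (_×_; ∃; ∃-syntax)
open import Data.Sum using (_⊎_)
open import Relation.Nullary using (¬_)
open import Relation.Binary.PropositionalEquality using (_≡_)
open import Relation.Binary.Construct.Closure.ReflexiveTransitive using (Star)

-- Partitions are represented as finite lists of parts λ₁ ≥ λ₂ ≥ … > 0.
-- `part λ i` is the (i+1)-th part λ_{i+1} (0-indexed), and 0 beyond the length.
part : List ℕ → ℕ → ℕ
part []       _       = 0
part (x ∷ _)  zero    = x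
part (_ ∷ xs) (suc i) = part xs i

IsPartition : List ℕ → Set
IsPartition λ′ = All (0 <_) λ′ × (∀ i → part λ′ (suc i) ≤ part λ′ i)

-- The skew shape λ/μ occupies exactly the rows a..b (0-indexed), each of them
-- nonempty, and consecutive rows overlap in exactly one column
-- (μ_i + 1 = λ_{i+1}, i.e. row i of λ/μ starts in the column where row i+1 ends):
-- this is exactly "λ/μ is connected and contains no 2×2 square".
RimRemoval : ℕ → List ℕ → List ℕ → Set
RimRemoval t λ′ μ =
  IsPartition μ ×
  (∀ i → part μ i ≤ part λ′ i) ×
  (sum λ′ ≡ sum μ + t) ×
  ∃[ a ] ∃[ b ] (a ≤ b ×
    (∀ i → (i < a ⊎ b < i) → part μ i ≡ part λ′ i) ×
    (∀ i → a ≤ i → i ≤ b → part μ i < part λ′ i) ×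
    (∀ i → a ≤ i → i < b → part μ i + 1 ≡ part λ′ (suc i)))

ReducesTo : ℕ → List ℕ → List ℕ → Set
ReducesTo t = Star (RimRemoval t)

IsCore : ℕ → List ℕ → Set
IsCore t κ = ∀ μ → ¬ RimRemoval t κ μ

TCoreOf : ℕ → List ℕ → List ℕ → Set
TCoreOf t λ′ κ = ReducesTo t λ′ κ × IsCore t κ

part₁ : List ℕ → ℕ → ℕ
part₁ λ′ i = part λ′ (i ∸ 1)

conj : List ℕ → ℕ → ℕ
conj λ′ i = length (filter (i ≤?_) λ′)

-- rank (Durfee size): largest r with λ_r ≥ r; for a partition this is the number
-- of r ∈ {1,…,ℓ(λ)} with λ_r ≥ r (λ_i - i is strictly decreasing).
rank : List ℕ → ℕ
rank λ′ = length (filter (λ r → r ≤? part₁ λ′ r) (map suc (upTo (length λ′))))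

-- Orthogonal partition (α | α - 1): λ'_i - i = λ_i - i - 1 for 1 ≤ i ≤ rank,
-- written in ℕ as λ'_i + 1 = λ_i (note λ_i ≥ i ≥ 1 there).
Orthogonal : List ℕ → Set
Orthogonal λ′ = ∀ i → 1 ≤ i → i ≤ rank λ′ → conj λ′ i + 1 ≡ part₁ λ′ i

beta : List ℕ → ℕ → List ℕ
beta λ′ m = map (λ j → part₁ λ′ j + m ∸ j) (map suc (upTo m))

nres : (t : ℕ) → .{{NonZero t}} → List ℕ → ℕ → ℕ → ℕ
nres t λ′ m i = length (filter (λ b → b % t ≟ i) (beta λ′ m))

{-# OPTIONS --safe #-}
module Submission where

-- With m = tn beads, λ is encoded by its β-set {λ_j + m − j}, and its t-abacus has the residue
-- classes mod t as runners, runner i carrying n_i beads.  Removing a t-strip moves one bead up its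
-- runner to an empty position, so the n_i are invariant and the t-core is the flush abacus in which
-- every runner is filled from the top.  A partition is orthogonal exactly when its β-set lies in
-- [0, 2m], avoids m, and contains exactly one of y and 2m − y for every y < m.  On a flush abacus
-- this reflection y ↦ 2m − y exchanges runners i and t − i row by row, so the symmetry amounts to
-- n_0 = n and n_i + n_{t−i} = 2n.

open import Defs
open import Data.Nat using (ℕ; _+_; _*_; _∸_; _≤_; NonZero)
open import Data.Nat.DivMod using (_/_)
open import Data.List using (List; length)
open import Data.Product using (_×_; ∃-syntax)
open import Function.Bundles using (_⇔_)
open import Relation.Binary.PropositionalEquality using (_≡_)

open import Data.Nat
open import Data.Nat.Properties
open import Data.Nat.DivMod using (_%_; m≡m%n+[m/n]*n; m%n<n; m/n<m; [m+kn]%n≡m%n; [m+n]%n≡m%n; m<n⇒m%n≡m)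
open import Data.Nat.ListAction using (sum)
open import Data.Nat.Tactic.RingSolver using (solve-∀)
open import Data.List using ([]; _∷_; _++_; [_]; filter; map; upTo)
open import Data.List.Properties using (upTo-∷ʳ; map-++; map-∘; filter-++; length-++; filter-accept; filter-reject)
open import Data.List.Relation.Unary.All using (All; []; _∷_)
open import Data.Product using (_,_; proj₁; proj₂)
open import Data.Sum using (_⊎_; inj₁; inj₂)
open import Data.Empty using (⊥-elim)
open import Function.Bundles using (mk⇔; Equivalence)
open import Function.Construct.Composition using (_⇔-∘_)
open import Function.Construct.Symmetry using (⇔-sym)
open import Relation.Nullary using (Dec; yes; no; ¬_; contradiction)
open import Relation.Nullary.Decidable using (¬?; _×-dec_)
open import Induction.WellFounded using (Acc; acc)
open import Data.Nat.Induction using (<-wellFounded)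
open import Relation.Unary using (Decidable)
open import Relation.Binary.Definitions using (tri<; tri≈; tri>)
open import Relation.Binary.PropositionalEquality using (refl; sym; trans; cong; cong₂; subst; subst₂; _≢_; module ≡-Reasoning)
open import Relation.Binary.Construct.Closure.ReflexiveTransitive using (ε; _◅_)

open Equivalence using (to; from)

+-right-comm : ∀ a b c → a + b + c ≡ a + c + b
+-right-comm = solve-∀

χ : {P : Set} → Dec P → ℕ
χ (yes _) = 1
χ (no _)  = 0

χ≤1 : {P : Set} (P? : Dec P) → χ P? ≤ 1
χ≤1 (yes _) = s≤s z≤n
χ≤1 (no _)  = z≤n

χ-yes : {P : Set} (P? : Dec P) → P → χ P? ≡ 1
χ-yes (yes _) _  = refl
χ-yes (no ¬p) p = ⊥-elim (¬p p)

χ-no : {P : Set} (P? : Dec P) → ¬ P → χ P? ≡ 0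
χ-no (yes p) ¬p = ⊥-elim (¬p p)
χ-no (no _)  _  = refl

∑ : (ℕ → ℕ) → ℕ → ℕ
∑ f zero    = 0
∑ f (suc n) = ∑ f n + f n

count : {P : ℕ → Set} → Decidable P → ℕ → ℕ
count P? = ∑ (λ i → χ (P? i))

∑-cong : ∀ {f g} n → (∀ i → i < n → f i ≡ g i) → ∑ f n ≡ ∑ g n
∑-cong zero    _  = refl
∑-cong (suc n) eq = cong₂ _+_ (∑-cong n (λ i i<n → eq i (m<n⇒m<1+n i<n))) (eq n ≤-refl)

∑-zero : ∀ {f} n → (∀ i → i < n → f i ≡ 0) → ∑ f n ≡ 0
∑-zero zero    _  = refl
∑-zero (suc n) eq = cong₂ _+_ (∑-zero n (λ i i<n → eq i (m<n⇒m<1+n i<n))) (eq n ≤-refl)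

∑-+ : ∀ f g n → ∑ (λ i → f i + g i) n ≡ ∑ f n + ∑ g n
∑-+ f g zero    = refl
∑-+ f g (suc n) = trans (cong (_+ (f n + g n)) (∑-+ f g n)) (interchange (∑ f n) (∑ g n) (f n) (g n))
  where
  interchange : ∀ a b c d → a + b + (c + d) ≡ a + c + (b + d)
  interchange = solve-∀

∑-split : ∀ f a b → ∑ f (a + b) ≡ ∑ f a + ∑ (λ i → f (a + i)) b
∑-split f a zero    = trans (cong (∑ f) (+-identityʳ a)) (sym (+-identityʳ (∑ f a)))
∑-split f a (suc b) = begin
  ∑ f (a + suc b)                                   ≡⟨ cong (∑ f) (+-suc a b) ⟩
  ∑ f (a + b) + f (a + b)                           ≡⟨ cong (_+ f (a + b)) (∑-split f a b) ⟩
  ∑ f a + ∑ (λ i → f (a + i)) b + f (a + b)         ≡⟨ +-assoc (∑ f a) _ _ ⟩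
  ∑ f a + ∑ (λ i → f (a + i)) (suc b)               ∎
  where open ≡-Reasoning

∑-mono-≤ : ∀ {f g} n → (∀ i → i < n → f i ≤ g i) → ∑ f n ≤ ∑ g n
∑-mono-≤ zero    _  = z≤n
∑-mono-≤ (suc n) le = +-mono-≤ (∑-mono-≤ n (λ i i<n → le i (m<n⇒m<1+n i<n))) (le n ≤-refl)

count≤ : ∀ {P : ℕ → Set} (P? : Decidable P) n → count P? n ≤ n
count≤ P? zero    = z≤n
count≤ P? (suc n) = subst (count P? n + χ (P? n) ≤_) (+-comm n 1) (+-mono-≤ (count≤ P? n) (χ≤1 (P? n)))

count-positive⇔∃ : ∀ {P : ℕ → Set} (P? : Decidable P) n → (1 ≤ count P? n) ⇔ (∃[ l ] (l < n × P l))
count-positive⇔∃ P? zero    = mk⇔ (λ ()) (λ { (_ , () , _) })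
count-positive⇔∃ P? (suc n) with P? n
... | yes p = mk⇔ (λ _ → n , ≤-refl , p) (λ _ → subst (1 ≤_) (+-comm 1 _) (s≤s z≤n))
... | no ¬p = mk⇔
  (λ pos → let (l , l<n , pl) = to (count-positive⇔∃ P? n) (subst (1 ≤_) (+-identityʳ _) pos)
           in l , m<n⇒m<1+n l<n , pl)
  (λ { (l , l<1+n , pl) → subst (1 ≤_) (sym (+-identityʳ _))
         (from (count-positive⇔∃ P? n) (l , ≤∧≢⇒< (≤-pred l<1+n) (λ { refl → ¬p pl }) , pl)) })

module DownClosed {P : ℕ → Set} (P? : Decidable P) (closed : ∀ j → P (suc j) → P j) where

  closed-≤ : ∀ {j k} → j ≤ k → P k → P j
  closed-≤ {j} j≤k pk = go (_ ∸ j) (subst P (sym (m∸n+n≡m j≤k)) pk)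
    where
    go : ∀ d → P (d + j) → P j
    go zero    p = p
    go (suc d) p = go d (closed (d + j) p)

  count-all : ∀ N → (∀ j → j < N → P j) → count P? N ≡ N
  count-all zero    _   = refl
  count-all (suc N) all = begin
    count P? N + χ (P? N) ≡⟨ cong₂ _+_ (count-all N (λ j j<N → all j (m<n⇒m<1+n j<N))) (χ-yes (P? N) (all N ≤-refl)) ⟩
    N + 1                 ≡⟨ +-comm N 1 ⟩
    suc N                 ∎
    where open ≡-Reasoning

  <count⇔ : ∀ N j → (j < count P? N) ⇔ (j < N × P j)
  <count⇔ zero    j = mk⇔ (λ ()) (λ ())
  <count⇔ (suc N) j with P? N
  ... | yes p = mk⇔ (λ j<N+1 → lt j<N+1 , closed-≤ (≤-pred (lt j<N+1)) p) (λ (j<N+1 , _) → gt j<N+1)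
    where
    all : count P? (suc N) ≡ suc N
    all = count-all (suc N) (λ k k<N+1 → closed-≤ (≤-pred k<N+1) p)
    lt : j < count P? N + 1 → j < suc N
    lt = subst (j <_) (trans (cong (count P? N +_) (sym (χ-yes (P? N) p))) all)
    gt : j < suc N → j < count P? N + 1
    gt = subst (j <_) (sym (trans (cong (count P? N +_) (sym (χ-yes (P? N) p))) all))
  ... | no ¬p = mk⇔
    (λ lt → let (j<N , pj) = to (<count⇔ N j) (subst (j <_) (+-identityʳ _) lt) in m<n⇒m<1+n j<N , pj)
    (λ (j<N+1 , pj) → subst (j <_) (sym (+-identityʳ _))
       (from (<count⇔ N j) (≤∧≢⇒< (≤-pred j<N+1) (λ { refl → ¬p pj }) , pj)))

∑-single : ∀ {f} r n → r < n → (∀ i → i < n → i ≢ r → f i ≡ 0) → ∑ f n ≡ f r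
∑-single {f} r (suc n) r<1+n others with m≤n⇒m<n∨m≡n (≤-pred r<1+n)
... | inj₁ r<n  = trans (cong₂ _+_ (∑-single r n r<n (λ i i<n → others i (m<n⇒m<1+n i<n)))
                                   (others n ≤-refl (λ { refl → <-irrefl refl r<n })))
                        (+-identityʳ (f r))
... | inj₂ refl = cong (_+ f r) (∑-zero r (λ i i<r → others i (m<n⇒m<1+n i<r) (<⇒≢ i<r)))

∑-blocks : ∀ f t q → ∑ f (q * t) ≡ ∑ (λ j → ∑ (λ s → f (s + j * t)) t) q
∑-blocks f t zero    = refl
∑-blocks f t (suc q) = begin
  ∑ f (t + q * t)                                         ≡⟨ cong (∑ f) (+-comm t (q * t)) ⟩
  ∑ f (q * t + t)                                         ≡⟨ ∑-split f (q * t) t ⟩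
  ∑ f (q * t) + ∑ (λ i → f (q * t + i)) t                 ≡⟨ cong₂ _+_ (∑-blocks f t q) (∑-cong t (λ i _ → cong f (+-comm (q * t) i))) ⟩
  ∑ (λ j → ∑ (λ s → f (s + j * t)) t) q + ∑ (λ s → f (s + q * t)) t ∎
  where open ≡-Reasoning

∑-shift-segment : ∀ (f g : ℕ → ℕ) {a b} → a ≤′ b → (∀ i → i < a → g i ≡ f i) →
  (∀ i → a ≤ i → i < b → g i ≡ f (suc i)) → ∑ g b + f a ≡ ∑ f (suc b)
∑-shift-segment f g ≤′-refl below _ = cong (_+ f _) (∑-cong _ below)
∑-shift-segment f g {a} (≤′-step {b} a≤′b) below shifted = begin
  ∑ g b + g b + f a       ≡⟨ +-right-comm (∑ g b) (g b) (f a) ⟩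
  ∑ g b + f a + g b       ≡⟨ cong₂ _+_ (∑-shift-segment f g a≤′b below (λ i a≤i i<b → shifted i a≤i (m<n⇒m<1+n i<b)))
                                      (shifted b (≤′⇒≤ a≤′b) ≤-refl) ⟩
  ∑ f (suc b) + f (suc b) ∎
  where open ≡-Reasoning

-- g is f with the entry f a deleted and the entry g b inserted at position b.
∑-rotate : ∀ (f g : ℕ → ℕ) {a b m} → a ≤ b → b < m → (∀ i → (i < a ⊎ b < i) → g i ≡ f i) →
  (∀ i → a ≤ i → i < b → g i ≡ f (suc i)) → ∑ g m + f a ≡ ∑ f m + g b
∑-rotate f g {a} {b} a≤b b<m outside shifted = go (≤⇒≤′ b<m)
  where
  open ≡-Reasoning
  go : ∀ {m} → suc b ≤′ m → ∑ g m + f a ≡ ∑ f m + g b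
  go ≤′-refl = begin
    ∑ g b + g b + f a ≡⟨ +-right-comm (∑ g b) (g b) (f a) ⟩
    ∑ g b + f a + g b ≡⟨ cong (_+ g b) (∑-shift-segment f g (≤⇒≤′ a≤b) (λ i i<a → outside i (inj₁ i<a)) shifted) ⟩
    ∑ f (suc b) + g b ∎
  go (≤′-step {m} b<m) = begin
    ∑ g m + g m + f a ≡⟨ +-right-comm (∑ g m) (g m) (f a) ⟩
    ∑ g m + f a + g m ≡⟨ cong₂ _+_ (go b<m) (outside m (inj₂ (≤′⇒≤ b<m))) ⟩
    ∑ f m + g b + f m ≡⟨ +-right-comm (∑ f m) (g b) (f m) ⟩
    ∑ f m + f m + g b ∎

length-filter-map-upTo : ∀ {P : ℕ → Set} (P? : Decidable P) (g : ℕ → ℕ) m →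
  length (filter P? (map g (upTo m))) ≡ count (λ i → P? (g i)) m
length-filter-map-upTo P? g zero    = refl
length-filter-map-upTo P? g (suc m) = begin
  length (filter P? (map g (upTo (suc m))))               ≡⟨ cong (λ xs → length (filter P? (map g xs))) (sym (upTo-∷ʳ m)) ⟩
  length (filter P? (map g (upTo m ++ [ m ])))            ≡⟨ cong (λ xs → length (filter P? xs)) (map-++ g (upTo m) [ m ]) ⟩
  length (filter P? (map g (upTo m) ++ [ g m ]))          ≡⟨ cong length (filter-++ P? (map g (upTo m)) [ g m ]) ⟩
  length (filter P? (map g (upTo m)) ++ filter P? [ g m ]) ≡⟨ length-++ (filter P? (map g (upTo m))) ⟩
  length (filter P? (map g (upTo m))) + length (filter P? [ g m ]) ≡⟨ cong₂ _+_ (length-filter-map-upTo P? g m) singleton ⟩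
  count (λ i → P? (g i)) m + χ (P? (g m))                ∎
  where
  open ≡-Reasoning
  singleton : length (filter P? [ g m ]) ≡ χ (P? (g m))
  singleton with P? (g m)
  ... | yes _ = refl
  ... | no _  = refl

count-injective≤1 : ∀ (f : ℕ → ℕ) y n → (∀ {i j} → i < n → j < n → f i ≡ f j → i ≡ j) →
  count (λ i → f i ≟ y) n ≤ 1
count-injective≤1 f y zero    _   = z≤n
count-injective≤1 f y (suc n) inj with f n ≟ y
... | yes fn≡y = ≤-reflexive (cong (_+ 1) (∑-zero n (λ i i<n → χ-no (f i ≟ y)
                   (λ fi≡y → <⇒≢ i<n (inj (m<n⇒m<1+n i<n) ≤-refl (trans fi≡y (sym fn≡y)))))))
... | no _     = subst (_≤ 1) (sym (+-identityʳ _))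
                   (count-injective≤1 f y n (λ i<n j<n → inj (m<n⇒m<1+n i<n) (m<n⇒m<1+n j<n)))

-- Partitions and β-numbers

part-antitone : ∀ {λ′} → IsPartition λ′ → ∀ {i j} → i ≤ j → part λ′ j ≤ part λ′ i
part-antitone {λ′} isP {i} i≤j = go (_ ∸ i) (sym (m∸n+n≡m i≤j))
  where
  go : ∀ d {j} → j ≡ d + i → part λ′ j ≤ part λ′ i
  go zero    refl = ≤-refl
  go (suc d) refl = ≤-trans (proj₂ isP (d + i)) (go d refl)

part-beyond-length : ∀ (λ′ : List ℕ) i → length λ′ ≤ i → part λ′ i ≡ 0
part-beyond-length []       i       _         = refl
part-beyond-length (_ ∷ λ′) (suc i) (s≤s len≤i) = part-beyond-length λ′ i len≤i

part-positive : ∀ {λ′ : List ℕ} → All (0 <_) λ′ → ∀ i → i < length λ′ → 0 < part λ′ i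
part-positive (p ∷ _)  zero    _          = p
part-positive (_ ∷ ps) (suc i) (s≤s i<len) = part-positive ps i i<len

length≤-of-part≡0 : ∀ {λ′ : List ℕ} → All (0 <_) λ′ → ∀ k → part λ′ k ≡ 0 → length λ′ ≤ k
length≤-of-part≡0 {λ′} pos k part≡0 with length λ′ ≤? k
... | yes len≤k = len≤k
... | no  len≰k = contradiction (sym part≡0) (<⇒≢ (part-positive pos k (≰⇒> len≰k)))

sum≡∑part : ∀ (λ′ : List ℕ) m → length λ′ ≤ m → sum λ′ ≡ ∑ (part λ′) m
sum≡∑part []       m       _         = sym (∑-zero m (λ _ _ → refl))
sum≡∑part (p ∷ λ′) (suc m) (s≤s len≤m) =
  trans (cong (p +_) (sum≡∑part λ′ m len≤m)) (sym (∑-split (part (p ∷ λ′)) 1 m))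

record BoundedPartition (m : ℕ) (λ′ : List ℕ) : Set where
  field
    isPartition : IsPartition λ′
    length≤     : length λ′ ≤ m

-- β λ′ m i is the (i+1)-th entry of beta λ′ m.
β : List ℕ → ℕ → ℕ → ℕ
β λ′ m i = part λ′ i + m ∸ suc i

β+index : ∀ λ′ m i → i < m → β λ′ m i + suc i ≡ part λ′ i + m
β+index λ′ m i i<m = m∸n+n≡m (≤-trans i<m (m≤n+m m (part λ′ i)))

∑β : ∀ (λ′ : List ℕ) m → ∑ (β λ′ m) m ≡ ∑ (part λ′) m + ∑ (λ i → m ∸ suc i) m
∑β λ′ m = trans (∑-cong m (λ i i<m → +-∸-assoc (part λ′ i) i<m)) (∑-+ (part λ′) (λ i → m ∸ suc i) m)

IsBeta : ℕ → List ℕ → ℕ → Set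
IsBeta m λ′ y = ∃[ l ] (l < m × β λ′ m l ≡ y)

module BetaSet {m : ℕ} {λ′ : List ℕ} (P : BoundedPartition m λ′) where
  open BoundedPartition P

  x : ℕ → ℕ
  x = β λ′ m

  part-beyond : ∀ i → m ≤ i → part λ′ i ≡ 0
  part-beyond i m≤i = part-beyond-length λ′ i (≤-trans length≤ m≤i)

  m≤x+index : ∀ i → i < m → m ≤ x i + suc i
  m≤x+index i i<m = subst (m ≤_) (sym (β+index λ′ m i i<m)) (m≤n+m m _)

  x-step-< : ∀ i → suc i < m → x (suc i) < x i
  x-step-< i 2+i≤m = +-cancelʳ-≤ (suc (suc i)) _ _ (begin
    suc (x (suc i)) + suc (suc i) ≡⟨ cong suc (β+index λ′ m (suc i) 2+i≤m) ⟩
    suc (part λ′ (suc i) + m)     ≤⟨ s≤s (+-monoˡ-≤ m (proj₂ isPartition i)) ⟩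
    suc (part λ′ i + m)           ≡⟨ cong suc (sym (β+index λ′ m i (<-trans (n<1+n i) 2+i≤m))) ⟩
    suc (x i + suc i)             ≡⟨ sym (+-suc (x i) (suc i)) ⟩
    x i + suc (suc i)             ∎)
    where open ≤-Reasoning

  x-beyond : ∀ i → m ≤ suc i → x (suc i) ≡ 0
  x-beyond i m≤1+i rewrite part-beyond (suc i) m≤1+i = m≤n⇒m∸n≡0 (m≤n⇒m≤1+n m≤1+i)

  x-step-≤ : ∀ i → x (suc i) ≤ x i
  x-step-≤ i with suc i <? m
  ... | yes 2+i≤m = <⇒≤ (x-step-< i 2+i≤m)
  ... | no  2+i≰m = subst (_≤ x i) (sym (x-beyond i (≮⇒≥ 2+i≰m))) z≤n

  x-antitone : ∀ {i j} → i ≤ j → x j ≤ x i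
  x-antitone {i} i≤j = go (_ ∸ i) (sym (m∸n+n≡m i≤j))
    where
    go : ∀ d {j} → j ≡ d + i → x j ≤ x i
    go zero    refl = ≤-refl
    go (suc d) refl = ≤-trans (x-step-≤ (d + i)) (go d refl)

  x-strictly-antitone : ∀ {i j} → i < j → j < m → x j < x i
  x-strictly-antitone {i} {suc j} (s≤s i≤j) j<m = <-≤-trans (x-step-< j j<m) (x-antitone i≤j)

  x-injective : ∀ {i j} → i < m → j < m → x i ≡ x j → i ≡ j
  x-injective {i} {j} i<m j<m xi≡xj with <-cmp i j
  ... | tri< i<j _ _ = contradiction (sym xi≡xj) (<⇒≢ (x-strictly-antitone i<j j<m))
  ... | tri≈ _ i≡j _ = i≡j
  ... | tri> _ _ j<i = contradiction xi≡xj (<⇒≢ (x-strictly-antitone j<i i<m))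

  count≥ : ℕ → ℕ
  count≥ p = count (λ l → p ≤? x l) m

  count≡ : ℕ → ℕ
  count≡ y = count (λ l → x l ≟ y) m

  private
    ≤x-closed : ∀ {p} j → p ≤ x (suc j) → p ≤ x j
    ≤x-closed j p≤x = ≤-trans p≤x (x-step-≤ j)

  <count≥⇔ : ∀ p l → (l < count≥ p) ⇔ (l < m × p ≤ x l)
  <count≥⇔ p l = DownClosed.<count⇔ (λ l → p ≤? x l) ≤x-closed m l

  count≥≤m : ∀ p → count≥ p ≤ m
  count≥≤m p = count≤ (λ l → p ≤? x l) m

  count≥-zero : count≥ 0 ≡ m
  count≥-zero = DownClosed.count-all (λ l → 0 ≤? x l) ≤x-closed m (λ _ _ → z≤n)

  count≡≤1 : ∀ y → count≡ y ≤ 1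
  count≡≤1 y = count-injective≤1 x y m x-injective

  count≡-0-or-1 : ∀ y → count≡ y ≡ 0 ⊎ count≡ y ≡ 1
  count≡-0-or-1 y with count≡ y | count≡≤1 y
  ... | zero     | _ = inj₁ refl
  ... | suc zero | _ = inj₂ refl
  ... | 2+ _     | s≤s ()

  count≡-positive⇔IsBeta : ∀ y → (1 ≤ count≡ y) ⇔ IsBeta m λ′ y
  count≡-positive⇔IsBeta y = count-positive⇔∃ (λ l → x l ≟ y) m

  count≥-step : ∀ p → count≥ p ≡ count≥ (suc p) + count≡ p
  count≥-step p = trans (∑-cong m (λ l _ → χ-≤-split (x l))) (∑-+ _ _ m)
    where
    χ-≤-split : ∀ v → χ (p ≤? v) ≡ χ (suc p ≤? v) + χ (v ≟ p)
    χ-≤-split v with v ≟ p | p ≤? v | suc p ≤? v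
    ... | yes refl | yes _   | no _    = refl
    ... | yes refl | _       | yes p<p = ⊥-elim (<-irrefl refl p<p)
    ... | yes refl | no p≰p  | _       = ⊥-elim (p≰p ≤-refl)
    ... | no _     | yes _   | yes _   = refl
    ... | no _     | no _    | no _    = refl
    ... | no v≢p   | yes p≤v | no p≮v  = ⊥-elim (p≮v (≤∧≢⇒< p≤v (λ p≡v → v≢p (sym p≡v))))
    ... | no _     | no p≰v  | yes p<v = ⊥-elim (p≰v (<⇒≤ p<v))

  count≥-antitone : ∀ {p q} → p ≤ q → count≥ q ≤ count≥ p
  count≥-antitone {p} {q} p≤q = ∑-mono-≤ m (λ l _ → χ-mono (x l))
    where
    χ-mono : ∀ v → χ (q ≤? v) ≤ χ (p ≤? v)
    χ-mono v with q ≤? v | p ≤? v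
    ... | yes _   | yes _   = ≤-refl
    ... | yes q≤v | no  p≰v = ⊥-elim (p≰v (≤-trans p≤q q≤v))
    ... | no _    | _       = z≤n

  count≥-lipschitz : ∀ p d → count≥ p ≤ count≥ (p + d) + d
  count≥-lipschitz p zero    = ≤-reflexive (trans (cong count≥ (sym (+-identityʳ p))) (sym (+-identityʳ _)))
  count≥-lipschitz p (suc d) = begin
    count≥ p                                          ≤⟨ count≥-lipschitz p d ⟩
    count≥ (p + d) + d                                ≡⟨ cong (_+ d) (count≥-step (p + d)) ⟩
    count≥ (suc (p + d)) + count≡ (p + d) + d         ≤⟨ +-monoˡ-≤ d (+-monoʳ-≤ (count≥ (suc (p + d))) (count≡≤1 (p + d))) ⟩
    count≥ (suc (p + d)) + 1 + d                      ≡⟨ +-assoc (count≥ (suc (p + d))) 1 d ⟩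
    count≥ (suc (p + d)) + suc d                      ≡⟨ cong (λ q → count≥ q + suc d) (sym (+-suc p d)) ⟩
    count≥ (p + suc d) + suc d                        ∎
    where open ≤-Reasoning

-- Border strips are β-number moves

fromParts : (ℕ → ℕ) → ℕ → List ℕ
fromParts f zero    = []
fromParts f (suc k) with f 0
... | zero  = []
... | suc v = suc v ∷ fromParts (λ i → f (suc i)) k

part-fromParts : ∀ f k → (∀ i → f (suc i) ≤ f i) → (∀ i → k ≤ i → f i ≡ 0) →
  ∀ i → part (fromParts f k) i ≡ f i
part-fromParts f zero    _    vanish i = sym (vanish i z≤n)
part-fromParts f (suc k) anti vanish i with f 0 in f0≡
... | zero = sym (n≤0⇒n≡0 (subst (f i ≤_) f0≡ (f≤f0 i)))
  where
  f≤f0 : ∀ i → f i ≤ f 0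
  f≤f0 zero    = ≤-refl
  f≤f0 (suc i) = ≤-trans (anti i) (f≤f0 i)
... | suc _ with i
...   | zero   = sym f0≡
...   | suc i′ = part-fromParts (λ i → f (suc i)) k (λ i → anti (suc i)) (λ i k≤i → vanish (suc i) (s≤s k≤i)) i′

fromParts-positive : ∀ f k → All (0 <_) (fromParts f k)
fromParts-positive f zero    = []
fromParts-positive f (suc k) with f 0
... | zero  = []
... | suc _ = s≤s z≤n ∷ fromParts-positive (λ i → f (suc i)) k

length-fromParts : ∀ f k → length (fromParts f k) ≤ k
length-fromParts f zero    = z≤n
length-fromParts f (suc k) with f 0
... | zero  = z≤n
... | suc _ = s≤s (length-fromParts (λ i → f (suc i)) k)

fromParts-bounded : ∀ f k → (∀ i → f (suc i) ≤ f i) → (∀ i → k ≤ i → f i ≡ 0) → BoundedPartition k (fromParts f k)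
fromParts-bounded f k anti vanish = record
  { isPartition = fromParts-positive f k , (λ i → subst₂ _≤_ (sym (parts (suc i))) (sym (parts i)) (anti i))
  ; length≤     = length-fromParts f k
  }
  where
  parts = part-fromParts f k anti vanish

record StripShape (m : ℕ) (λ′ μ : List ℕ) (a b : ℕ) : Set where
  field
    a≤b     : a ≤ b
    b<m     : b < m
    outside : ∀ i → (i < a ⊎ b < i) → part μ i ≡ part λ′ i
    shifted : ∀ i → a ≤ i → i < b → part μ i + 1 ≡ part λ′ (suc i)

module _ {m λ′ μ a b} (shape : StripShape m λ′ μ a b) where
  open StripShape shape

  β-outside : ∀ i → (i < a ⊎ b < i) → β μ m i ≡ β λ′ m i
  β-outside i i∉[a,b] = cong (λ p → p + m ∸ suc i) (outside i i∉[a,b])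

  β-shifted : ∀ i → a ≤ i → i < b → β μ m i ≡ β λ′ m (suc i)
  β-shifted i a≤i i<b = cong (λ p → p + m ∸ suc (suc i)) (trans (+-comm 1 (part μ i)) (shifted i a≤i i<b))

  -- Removing the strip deletes the β-number β λ′ m a and inserts β μ m b.
  ∑-β-strip : ∀ h → ∑ (λ i → h (β μ m i)) m + h (β λ′ m a) ≡ ∑ (λ i → h (β λ′ m i)) m + h (β μ m b)
  ∑-β-strip h = ∑-rotate (λ i → h (β λ′ m i)) (λ i → h (β μ m i)) a≤b b<m
    (λ i i∉[a,b] → cong h (β-outside i i∉[a,b])) (λ i a≤i i<b → cong h (β-shifted i a≤i i<b))

  ∑part-strip : ∑ (part μ) m + β λ′ m a ≡ ∑ (part λ′) m + β μ m b
  ∑part-strip = +-cancelʳ-≡ C _ _ (begin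
    ∑ (part μ) m + β λ′ m a + C  ≡⟨ +-right-comm (∑ (part μ) m) (β λ′ m a) C ⟩
    ∑ (part μ) m + C + β λ′ m a  ≡⟨ cong (_+ β λ′ m a) (sym (∑β μ m)) ⟩
    ∑ (β μ m) m + β λ′ m a       ≡⟨ ∑-β-strip (λ y → y) ⟩
    ∑ (β λ′ m) m + β μ m b       ≡⟨ cong (_+ β μ m b) (∑β λ′ m) ⟩
    ∑ (part λ′) m + C + β μ m b  ≡⟨ +-right-comm (∑ (part λ′) m) C (β μ m b) ⟩
    ∑ (part λ′) m + β μ m b + C  ∎)
    where
    open ≡-Reasoning
    C = ∑ (λ i → m ∸ suc i) m

record BetaMove (t m : ℕ) (λ′ μ : List ℕ) : Set where
  field
    {a b} : ℕ
    shape : StripShape m λ′ μ a b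
    moved : β μ m b + t ≡ β λ′ m a

removal⇒move : ∀ {t m λ′ μ} → BoundedPartition m λ′ → RimRemoval t λ′ μ → BoundedPartition m μ × BetaMove t m λ′ μ
removal⇒move {t} {m} {λ′} {μ} λ′-bdd (isP-μ , μ⊆λ′ , sizes , a , b , a≤b , outside , shrunk , shifted) =
  μ-bdd , record { shape = shape ; moved = moved }
  where
  open BoundedPartition λ′-bdd
  b<m : b < m
  b<m with b <? m
  ... | yes b<m = b<m
  ... | no  b≮m = ⊥-elim (n≮0 (subst (part μ b <_) (part-beyond-length λ′ b (≤-trans length≤ (≮⇒≥ b≮m))) (shrunk b a≤b ≤-refl)))
  μ-bdd : BoundedPartition m μ
  μ-bdd = record
    { isPartition = isP-μ
    ; length≤     = length≤-of-part≡0 (proj₁ isP-μ) m (n≤0⇒n≡0 (≤-trans (μ⊆λ′ m) (≤-reflexive (part-beyond-length λ′ m length≤))))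
    }
  shape : StripShape m λ′ μ a b
  shape = record { a≤b = a≤b ; b<m = b<m ; outside = outside ; shifted = shifted }
  moved : β μ m b + t ≡ β λ′ m a
  moved = sym (+-cancelˡ-≡ (∑ (part μ) m) _ _ (begin
    ∑ (part μ) m + β λ′ m a      ≡⟨ ∑part-strip shape ⟩
    ∑ (part λ′) m + β μ m b      ≡⟨ cong (_+ β μ m b) ∑λ′ ⟩
    ∑ (part μ) m + t + β μ m b   ≡⟨ +-assoc (∑ (part μ) m) t _ ⟩
    ∑ (part μ) m + (t + β μ m b) ≡⟨ cong (∑ (part μ) m +_) (+-comm t _) ⟩
    ∑ (part μ) m + (β μ m b + t) ∎))
    where
    open ≡-Reasoning
    ∑λ′ : ∑ (part λ′) m ≡ ∑ (part μ) m + t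
    ∑λ′ = trans (sym (sum≡∑part λ′ m length≤)) (trans sizes (cong (_+ t) (sum≡∑part μ m (BoundedPartition.length≤ μ-bdd))))

module _ {t m λ′ μ} (move : BetaMove t m λ′ μ) where
  open BetaMove move
  open StripShape shape

  ∑-periodic-invariant : ∀ h → (∀ y → h (y + t) ≡ h y) → ∑ (λ i → h (β μ m i)) m ≡ ∑ (λ i → h (β λ′ m i)) m
  ∑-periodic-invariant h periodic = +-cancelʳ-≡ (h (β λ′ m a)) _ _
    (trans (∑-β-strip shape h) (cong (∑ (λ i → h (β λ′ m i)) m +_) (trans (sym (periodic _)) (cong h moved))))

  move-target-not-beta : 1 ≤ t → BoundedPartition m μ → ∀ l → l < m → β λ′ m l ≢ β μ m b
  move-target-not-beta 1≤t μ-bdd l l<m xl≡ with <-cmp l a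
  ... | tri< l<a _ _ = <⇒≢ (<-≤-trans l<a a≤b) (x-injective l<m b<m (trans (β-outside shape l (inj₁ l<a)) xl≡))
    where open BetaSet μ-bdd
  ... | tri≈ _ refl _ = <⇒≢ 1≤t (sym (+-cancelˡ-≡ (β μ m b) t 0 (trans (trans moved xl≡) (sym (+-identityʳ _)))))
  ... | tri> _ _ a<l = after-a l a<l l<m xl≡
    where
    open BetaSet μ-bdd
    after-a : ∀ l → a < l → l < m → β λ′ m l ≢ β μ m b
    after-a (suc l) a<1+l 1+l<m xl≡ with suc l ≤? b
    ... | yes 1+l≤b = <⇒≢ 1+l≤b (x-injective (<-trans (n<1+n l) 1+l<m) b<m
                        (trans (β-shifted shape l (≤-pred a<1+l) 1+l≤b) xl≡))
    ... | no  1+l≰b = <⇒≢ (≰⇒> 1+l≰b) (sym (x-injective 1+l<m b<m (trans (β-outside shape (suc l) (inj₂ (≰⇒> 1+l≰b))) xl≡)))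

module StripOfMove {t m : ℕ} (1≤t : 1 ≤ t) {λ′ : List ℕ} (λ′-bdd : BoundedPartition m λ′) {a : ℕ} (a<m : a < m)
  (t≤xa : t ≤ β λ′ m a) (target-free : ∀ l → l < m → β λ′ m l ≢ β λ′ m a ∸ t) where
  open BoundedPartition λ′-bdd
  open BetaSet λ′-bdd

  c : ℕ
  c = x a ∸ t

  c+t≡xa : c + t ≡ x a
  c+t≡xa = m∸n+n≡m t≤xa

  c<xa : c < x a
  c<xa = subst (c <_) c+t≡xa (subst (_≤ c + t) (+-comm c 1) (+-monoʳ-≤ c 1≤t))

  a<count : a < count≥ (suc c)
  a<count = from (<count≥⇔ (suc c) a) (a<m , c<xa)

  -- b is the last index whose β-number exceeds c, so c is reinserted at position b.
  b : ℕ
  b = count≥ (suc c) ∸ 1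

  1+b≡count : suc b ≡ count≥ (suc c)
  1+b≡count = trans (+-comm 1 b) (m∸n+n≡m (≤-trans (s≤s z≤n) a<count))

  a≤b : a ≤ b
  a≤b = ≤-pred (subst (suc a ≤_) (sym 1+b≡count) a<count)

  b<m : b < m
  b<m = subst (_≤ m) (sym 1+b≡count) (count≥≤m (suc c))

  c<x-upto-b : ∀ l → l ≤ b → c < x l
  c<x-upto-b l l≤b = proj₂ (to (<count≥⇔ (suc c) l) (subst (suc l ≤_) 1+b≡count (s≤s l≤b)))

  x<c-after-b : ∀ l → b < l → l < m → x l < c
  x<c-after-b l b<l l<m with suc c ≤? x l
  ... | yes c<xl = ⊥-elim (<⇒≱ (subst (_< suc l) 1+b≡count (s≤s b<l)) (from (<count≥⇔ (suc c) l) (l<m , c<xl)))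
  ... | no  c≮xl = ≤∧≢⇒< (≤-pred (≰⇒> c≮xl)) (target-free l l<m)

  D : ℕ
  D = m ∸ suc b

  D+1+b≡m : D + suc b ≡ m
  D+1+b≡m = m∸n+n≡m b<m

  D≤c : D ≤ c
  D≤c = +-cancelʳ-≤ (suc b) D c (subst (_≤ c + suc b) (sym D+1+b≡m) m≤c+1+b)
    where
    m≤c+1+b : m ≤ c + suc b
    m≤c+1+b with suc b <? m
    ... | yes 2+b≤m = begin
      m                        ≤⟨ m≤x+index (suc b) 2+b≤m ⟩
      x (suc b) + suc (suc b)  ≡⟨ +-suc (x (suc b)) (suc b) ⟩
      suc (x (suc b)) + suc b  ≤⟨ +-monoˡ-≤ (suc b) (x<c-after-b (suc b) ≤-refl 2+b≤m) ⟩
      c + suc b                ∎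
      where open ≤-Reasoning
    ... | no 2+b≰m = ≤-trans (≮⇒≥ 2+b≰m) (m≤n+m (suc b) c)

  xb≡ : x b ≡ part λ′ b + D
  xb≡ = +-cancelʳ-≡ (suc b) _ _ (trans (β+index λ′ m b b<m)
          (trans (cong (part λ′ b +_) (sym D+1+b≡m)) (sym (+-assoc (part λ′ b) D (suc b)))))

  c∸D<part-b : c ∸ D < part λ′ b
  c∸D<part-b = +-cancelʳ-≤ D _ _ (begin
    suc (c ∸ D + D) ≡⟨ cong suc (m∸n+n≡m D≤c) ⟩
    suc c           ≤⟨ c<x-upto-b b ≤-refl ⟩
    x b             ≡⟨ xb≡ ⟩
    part λ′ b + D   ∎)
    where open ≤-Reasoning

  part-positive-upto-b : ∀ l → l ≤ b → 1 ≤ part λ′ l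
  part-positive-upto-b l l≤b = ≤-trans (≤-trans (s≤s z≤n) c∸D<part-b) (part-antitone isPartition l≤b)

  part-after-b≤c∸D : part λ′ (suc b) ≤ c ∸ D
  part-after-b≤c∸D with suc b <? m
  ... | yes 2+b≤m = +-cancelʳ-≤ D _ _ (begin
    part λ′ (suc b) + D ≡⟨ +-cancelʳ-≡ (suc b) _ _ (begin-equality
        part λ′ (suc b) + D + suc b   ≡⟨ +-assoc (part λ′ (suc b)) D (suc b) ⟩
        part λ′ (suc b) + (D + suc b) ≡⟨ cong (part λ′ (suc b) +_) D+1+b≡m ⟩
        part λ′ (suc b) + m           ≡⟨ sym (β+index λ′ m (suc b) 2+b≤m) ⟩
        x (suc b) + suc (suc b)       ≡⟨ +-suc (x (suc b)) (suc b) ⟩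
        suc (x (suc b)) + suc b       ∎) ⟩
    suc (x (suc b))     ≤⟨ x<c-after-b (suc b) ≤-refl 2+b≤m ⟩
    c                   ≡⟨ sym (m∸n+n≡m D≤c) ⟩
    c ∸ D + D           ∎)
    where open ≤-Reasoning
  ... | no 2+b≰m = subst (_≤ c ∸ D) (sym (part-beyond (suc b) (≮⇒≥ 2+b≰m))) z≤n

  newPart : ℕ → ℕ
  newPart i with i <? a
  ... | yes _ = part λ′ i
  ... | no _ with i <? b
  ...   | yes _ = part λ′ (suc i) ∸ 1
  ...   | no _ with i ≟ b
  ...     | yes _ = c ∸ D
  ...     | no _  = part λ′ i

  newPart-before : ∀ i → i < a → newPart i ≡ part λ′ i
  newPart-before i i<a with i <? a
  ... | yes _   = refl
  ... | no  i≮a = contradiction i<a i≮a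

  newPart-inside : ∀ i → a ≤ i → i < b → newPart i ≡ part λ′ (suc i) ∸ 1
  newPart-inside i a≤i i<b with i <? a
  ... | yes i<a = contradiction a≤i (<⇒≱ i<a)
  ... | no _ with i <? b
  ...   | yes _   = refl
  ...   | no  i≮b = contradiction i<b i≮b

  newPart-at-b : newPart b ≡ c ∸ D
  newPart-at-b with b <? a
  ... | yes b<a = contradiction a≤b (<⇒≱ b<a)
  ... | no _ with b <? b
  ...   | yes b<b = contradiction b<b (<-irrefl refl)
  ...   | no _ with b ≟ b
  ...     | yes _   = refl
  ...     | no  b≢b = contradiction refl b≢b

  newPart-after : ∀ i → b < i → newPart i ≡ part λ′ i
  newPart-after i b<i with i <? a
  ... | yes _ = refl
  ... | no _ with i <? b
  ...   | yes i<b = contradiction b<i (<-asym i<b)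
  ...   | no _ with i ≟ b
  ...     | yes i≡b = contradiction (sym i≡b) (<⇒≢ b<i)
  ...     | no _    = refl

  data Position (i : ℕ) : Set where
    before : i < a → Position i
    inside : a ≤ i → i < b → Position i
    at-b   : i ≡ b → Position i
    after  : b < i → Position i

  position : ∀ i → Position i
  position i with i <? a
  ... | yes i<a = before i<a
  ... | no  i≮a with <-cmp i b
  ...   | tri< i<b _ _ = inside (≮⇒≥ i≮a) i<b
  ...   | tri≈ _ i≡b _ = at-b i≡b
  ...   | tri> _ _ b<i = after b<i

  newPart-outside : ∀ i → (i < a ⊎ b < i) → newPart i ≡ part λ′ i
  newPart-outside i (inj₁ i<a) = newPart-before i i<a
  newPart-outside i (inj₂ b<i) = newPart-after i b<i

  newPart-shifted : ∀ i → a ≤ i → i < b → newPart i + 1 ≡ part λ′ (suc i)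
  newPart-shifted i a≤i i<b = trans (cong (_+ 1) (newPart-inside i a≤i i<b)) (m∸n+n≡m (part-positive-upto-b (suc i) i<b))

  newPart-shrunk : ∀ i → a ≤ i → i ≤ b → newPart i < part λ′ i
  newPart-shrunk i a≤i i≤b with position i
  ... | before i<a    = contradiction a≤i (<⇒≱ i<a)
  ... | inside _ i<b  = subst (_< part λ′ i) (sym (newPart-inside i a≤i i<b))
                          (<-≤-trans (∸-monoʳ-< (s≤s z≤n) (part-positive-upto-b (suc i) i<b)) (proj₂ isPartition i))
  ... | at-b refl     = subst (_< part λ′ b) (sym newPart-at-b) c∸D<part-b
  ... | after b<i     = contradiction i≤b (<⇒≱ b<i)

  newPart≤part : ∀ i → newPart i ≤ part λ′ i
  newPart≤part i with position i
  ... | before i<a     = ≤-reflexive (newPart-before i i<a)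
  ... | inside a≤i i<b = <⇒≤ (newPart-shrunk i a≤i (<⇒≤ i<b))
  ... | at-b refl      = <⇒≤ (newPart-shrunk b a≤b ≤-refl)
  ... | after b<i      = ≤-reflexive (newPart-after i b<i)

  newPart-vanishes : ∀ i → m ≤ i → newPart i ≡ 0
  newPart-vanishes i m≤i = trans (newPart-after i (<-≤-trans b<m m≤i)) (part-beyond i m≤i)

  newPart-antitone : ∀ i → newPart (suc i) ≤ newPart i
  newPart-antitone i with position i
  ... | before i<a = subst (newPart (suc i) ≤_) (sym (newPart-before i i<a)) (≤-trans (newPart≤part (suc i)) (proj₂ isPartition i))
  ... | at-b refl  = subst₂ _≤_ (sym (newPart-after (suc b) ≤-refl)) (sym newPart-at-b) part-after-b≤c∸D
  ... | after b<i  = subst₂ _≤_ (sym (newPart-after (suc i) (m<n⇒m<1+n b<i))) (sym (newPart-after i b<i)) (proj₂ isPartition i)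
  ... | inside a≤i i<b with m≤n⇒m<n∨m≡n i<b
  ...   | inj₁ 1+i<b  = subst₂ _≤_ (sym (newPart-inside (suc i) (m≤n⇒m≤1+n a≤i) 1+i<b)) (sym (newPart-inside i a≤i i<b))
                          (∸-monoˡ-≤ 1 (proj₂ isPartition (suc i)))
  ...   | inj₂ 1+i≡b  = subst₂ _≤_ (sym (trans (cong newPart 1+i≡b) newPart-at-b)) (sym (newPart-inside i a≤i i<b))
                          (∸-monoˡ-≤ 1 (subst (λ k → c ∸ D < part λ′ k) (sym 1+i≡b) c∸D<part-b))

  μ : List ℕ
  μ = fromParts newPart m

  part-μ : ∀ i → part μ i ≡ newPart i
  part-μ = part-fromParts newPart m newPart-antitone newPart-vanishes

  μ-bdd : BoundedPartition m μ
  μ-bdd = fromParts-bounded newPart m newPart-antitone newPart-vanishes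

  shape : StripShape m λ′ μ a b
  shape = record
    { a≤b     = a≤b
    ; b<m     = b<m
    ; outside = λ i i∉[a,b] → trans (part-μ i) (newPart-outside i i∉[a,b])
    ; shifted = λ i a≤i i<b → trans (cong (_+ 1) (part-μ i)) (newPart-shifted i a≤i i<b)
    }

  βμb≡c : β μ m b ≡ c
  βμb≡c = begin
    part μ b + m ∸ suc b             ≡⟨ cong (λ p → p + m ∸ suc b) (trans (part-μ b) newPart-at-b) ⟩
    c ∸ D + m ∸ suc b                ≡⟨ cong (λ k → c ∸ D + k ∸ suc b) (sym D+1+b≡m) ⟩
    c ∸ D + (D + suc b) ∸ suc b      ≡⟨ cong (_∸ suc b) (sym (+-assoc (c ∸ D) D (suc b))) ⟩
    c ∸ D + D + suc b ∸ suc b        ≡⟨ m+n∸n≡m (c ∸ D + D) (suc b) ⟩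
    c ∸ D + D                        ≡⟨ m∸n+n≡m D≤c ⟩
    c                                ∎
    where open ≡-Reasoning

  sum-λ′ : sum λ′ ≡ sum μ + t
  sum-λ′ = begin
    sum λ′                 ≡⟨ sum≡∑part λ′ m length≤ ⟩
    ∑ (part λ′) m          ≡⟨ +-cancelʳ-≡ c _ _ (begin
        ∑ (part λ′) m + c       ≡⟨ cong (∑ (part λ′) m +_) (sym βμb≡c) ⟩
        ∑ (part λ′) m + β μ m b ≡⟨ sym (∑part-strip shape) ⟩
        ∑ (part μ) m + x a      ≡⟨ cong (∑ (part μ) m +_) (trans (sym c+t≡xa) (+-comm c t)) ⟩
        ∑ (part μ) m + (t + c)  ≡⟨ sym (+-assoc (∑ (part μ) m) t c) ⟩
        ∑ (part μ) m + t + c    ∎) ⟩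
    ∑ (part μ) m + t       ≡⟨ cong (_+ t) (sym (sum≡∑part μ m (BoundedPartition.length≤ μ-bdd))) ⟩
    sum μ + t              ∎
    where open ≡-Reasoning

  removal : RimRemoval t λ′ μ
  removal = BoundedPartition.isPartition μ-bdd
          , (λ i → subst (_≤ part λ′ i) (sym (part-μ i)) (newPart≤part i))
          , sum-λ′
          , a , b , a≤b , StripShape.outside shape
          , (λ i a≤i i≤b → subst (_< part λ′ i) (sym (part-μ i)) (newPart-shrunk i a≤i i≤b))
          , StripShape.shifted shape

-- On the t-abacus with m beads at the β-numbers, no bead of a flush partition can slide up.
IsFlush : ℕ → ℕ → List ℕ → Set
IsFlush t m λ′ = ∀ l → l < m → t ≤ β λ′ m l → IsBeta m λ′ (β λ′ m l ∸ t)

Movable : ℕ → ℕ → List ℕ → ℕ → Set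
Movable t m λ′ l = t ≤ β λ′ m l × ¬ IsBeta m λ′ (β λ′ m l ∸ t)

flush-or-movable : ∀ t m λ′ → IsFlush t m λ′ ⊎ ∃[ l ] (l < m × Movable t m λ′ l)
flush-or-movable t m λ′ with anyUpTo? (λ l → (t ≤? β λ′ m l) ×-dec ¬? (target? l)) m
  where
  target? : ∀ l → Dec (IsBeta m λ′ (β λ′ m l ∸ t))
  target? l = anyUpTo? (λ l′ → β λ′ m l′ ≟ β λ′ m l ∸ t) m
... | yes movable = inj₂ movable
... | no  stuck   = inj₁ flush
  where
  flush : IsFlush t m λ′
  flush l l<m t≤xl with anyUpTo? (λ l′ → β λ′ m l′ ≟ β λ′ m l ∸ t) m
  ... | yes target = target
  ... | no  free   = ⊥-elim (stuck (l , l<m , t≤xl , free))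

module _ {t m : ℕ} (1≤t : 1 ≤ t) where

  flush⇒core : ∀ {κ} → BoundedPartition m κ → IsFlush t m κ → IsCore t κ
  flush⇒core {κ} κ-bdd flush μ removal with removal⇒move κ-bdd removal
  ... | μ-bdd , move = source-not-flush (flush a (≤-<-trans a≤b b<m) (subst (t ≤_) moved (m≤n+m t _)))
    where
    open BetaMove move
    open StripShape shape
    source-not-flush : ¬ IsBeta m κ (β κ m a ∸ t)
    source-not-flush (l , l<m , xl≡) =
      move-target-not-beta move 1≤t μ-bdd l l<m (trans xl≡ (trans (cong (_∸ t) (sym moved)) (m+n∸n≡m _ t)))

  movable⇒removal : ∀ {λ′} → BoundedPartition m λ′ → ∀ l → l < m → Movable t m λ′ l →
    ∃[ μ ] (RimRemoval t λ′ μ × BoundedPartition m μ)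
  movable⇒removal λ′-bdd l l<m (t≤xl , free) = S.μ , S.removal , S.μ-bdd
    where module S = StripOfMove 1≤t λ′-bdd l<m t≤xl (λ l′ l′<m xl′≡ → free (l′ , l′<m , xl′≡))

  core⇒flush : ∀ {κ} → BoundedPartition m κ → IsCore t κ → IsFlush t m κ
  core⇒flush {κ} κ-bdd core with flush-or-movable t m κ
  ... | inj₁ flush                = flush
  ... | inj₂ (l , l<m , movable) with movable⇒removal κ-bdd l l<m movable
  ...   | μ , removal , _          = ⊥-elim (core μ removal)

  reduce-to-flush : ∀ {λ′} → BoundedPartition m λ′ → ∃[ κ ] (ReducesTo t λ′ κ × BoundedPartition m κ × IsFlush t m κ)
  reduce-to-flush λ′-bdd = go λ′-bdd (<-wellFounded _)
    where
    go : ∀ {λ′} → BoundedPartition m λ′ → Acc _<_ (sum λ′) → ∃[ κ ] (ReducesTo t λ′ κ × BoundedPartition m κ × IsFlush t m κ)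
    go {λ′} λ′-bdd (acc smaller) with flush-or-movable t m λ′
    ... | inj₁ flush = λ′ , ε , λ′-bdd , flush
    ... | inj₂ (l , l<m , movable) with movable⇒removal λ′-bdd l l<m movable
    ...   | μ , removal@(_ , _ , sizes , _) , μ-bdd with go μ-bdd (smaller (subst (sum μ <_) (sym sizes) (m<m+n (sum μ) 1≤t)))
    ...     | κ , reduction , κ-bdd , flush = κ , removal ◅ reduction , κ-bdd , flush

reduction-invariant : ∀ {t m λ′ κ} → BoundedPartition m λ′ → ReducesTo t λ′ κ →
  BoundedPartition m κ × (∀ h → (∀ y → h (y + t) ≡ h y) → ∑ (λ i → h (β κ m i)) m ≡ ∑ (λ i → h (β λ′ m i)) m)
reduction-invariant λ′-bdd ε = λ′-bdd , λ _ _ → refl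
reduction-invariant λ′-bdd (removal ◅ reduction) with removal⇒move λ′-bdd removal
... | μ-bdd , move with reduction-invariant μ-bdd reduction
...   | κ-bdd , invariant = κ-bdd , λ h periodic → trans (invariant h periodic) (∑-periodic-invariant move h periodic)

-- Orthogonal partitions have symmetric β-sets

<conj⇔≤part : ∀ (λ′ : List ℕ) → (∀ j → part λ′ (suc j) ≤ part λ′ j) →
  ∀ i k → 1 ≤ i → (k < conj λ′ i) ⇔ (i ≤ part λ′ k)
<conj⇔≤part []       _    i k 1≤i = mk⇔ (λ ()) (λ i≤0 → contradiction i≤0 (<⇒≱ 1≤i))
<conj⇔≤part (p ∷ λ′) anti i k 1≤i with i ≤? p
... | yes i≤p = shift k
  where
  conj≡ : conj (p ∷ λ′) i ≡ suc (conj λ′ i)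
  conj≡ = cong length (filter-accept (i ≤?_) i≤p)
  shift : ∀ k → (k < conj (p ∷ λ′) i) ⇔ (i ≤ part (p ∷ λ′) k)
  shift zero    = mk⇔ (λ _ → i≤p) (λ _ → subst (1 ≤_) (sym conj≡) (s≤s z≤n))
  shift (suc k) = mk⇔ (λ k<conj → to tail (≤-pred (subst (suc (suc k) ≤_) conj≡ k<conj)))
                      (λ i≤part → subst (suc (suc k) ≤_) (sym conj≡) (s≤s (from tail i≤part)))
    where tail = <conj⇔≤part λ′ (λ j → anti (suc j)) i k 1≤i
... | no i≰p = mk⇔ (λ k<conj → contradiction (subst (k <_) conj≡0 k<conj) λ ())
                   (λ i≤part → contradiction (≤-trans i≤part (part≤head k)) i≰p)
  where
  part≤head : ∀ k → part (p ∷ λ′) k ≤ p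
  part≤head zero    = ≤-refl
  part≤head (suc k) = ≤-trans (anti k) (part≤head k)
  conj-empty : ∀ (λ″ : List ℕ) → (∀ j → part λ″ j ≤ p) → conj λ″ i ≡ 0
  conj-empty []       _       = refl
  conj-empty (q ∷ λ″) bounded = trans (cong length (filter-reject (i ≤?_) (λ i≤q → i≰p (≤-trans i≤q (bounded 0)))))
                                      (conj-empty λ″ (λ j → bounded (suc j)))
  conj≡0 : conj (p ∷ λ′) i ≡ 0
  conj≡0 = trans (cong length (filter-reject (i ≤?_) i≰p)) (conj-empty λ′ (λ j → part≤head (suc j)))

≤rank⇔≤part : ∀ (λ′ : List ℕ) → IsPartition λ′ → ∀ i → 1 ≤ i → (i ≤ rank λ′) ⇔ (i ≤ part λ′ (i ∸ 1))
≤rank⇔≤part λ′ (_ , anti) (suc j) _ = mk⇔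
  (λ j<rank → proj₂ (to (diagonal j) (subst (j <_) rank≡ j<rank)))
  (λ j<part → subst (j <_) (sym rank≡) (from (diagonal j) (j<length j<part , j<part)))
  where
  rank≡ : rank λ′ ≡ count (λ l → suc l ≤? part λ′ l) (length λ′)
  rank≡ = length-filter-map-upTo (λ r → r ≤? part₁ λ′ r) suc (length λ′)
  diagonal : ∀ j → (j < count (λ l → suc l ≤? part λ′ l) (length λ′)) ⇔ (j < length λ′ × suc j ≤ part λ′ j)
  diagonal = DownClosed.<count⇔ (λ l → suc l ≤? part λ′ l)
    (λ l 2+l≤part → ≤-trans (n≤1+n (suc l)) (≤-trans 2+l≤part (anti l))) (length λ′)
  j<length : suc j ≤ part λ′ j → j < length λ′
  j<length j<part with j <? length λ′
  ... | yes j<len = j<len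
  ... | no  j≮len = contradiction (subst (suc j ≤_) (part-beyond-length λ′ j (≮⇒≥ j≮len)) j<part) λ ()

≡-by-positive-lower-bounds : ∀ u v → (∀ i → 1 ≤ i → i ≤ u → i ≤ v) → (∀ i → 1 ≤ i → i ≤ v → i ≤ u) → u ≡ v
≡-by-positive-lower-bounds zero    zero    _     _     = refl
≡-by-positive-lower-bounds zero    (suc v) _     v⇒u = contradiction (v⇒u (suc v) (s≤s z≤n) ≤-refl) λ ()
≡-by-positive-lower-bounds (suc u) zero    u⇒v _     = contradiction (u⇒v (suc u) (s≤s z≤n) ≤-refl) λ ()
≡-by-positive-lower-bounds (suc u) (suc v) u⇒v v⇒u = ≤-antisym (u⇒v (suc u) (s≤s z≤n) ≤-refl) (v⇒u (suc v) (s≤s z≤n) ≤-refl)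

+1≡⇒≤⇔suc≤ : ∀ {u v} → u + 1 ≡ v → ∀ K → (K ≤ u) ⇔ (suc K ≤ v)
+1≡⇒≤⇔suc≤ {u} refl K = mk⇔ (λ K≤u → subst (suc K ≤_) (+-comm 1 u) (s≤s K≤u))
                             (λ K<u+1 → ≤-pred (subst (suc K ≤_) (+-comm u 1) K<u+1))

≤⇔suc≤⇒+1≡ : ∀ {u v} → 1 ≤ v → (∀ K → 1 ≤ K → (K ≤ u) ⇔ (suc K ≤ v)) → u + 1 ≡ v
≤⇔suc≤⇒+1≡ {u} {v} 1≤v bounds = ≡-by-positive-lower-bounds (u + 1) v u+1⇒v v⇒u+1
  where
  u+1⇒v : ∀ j → 1 ≤ j → j ≤ u + 1 → j ≤ v
  u+1⇒v 1            _ _       = 1≤v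
  u+1⇒v (suc (suc K)) _ K<u+1 = to (bounds (suc K) (s≤s z≤n)) (≤-pred (subst (suc (suc K) ≤_) (+-comm u 1) K<u+1))
  v⇒u+1 : ∀ j → 1 ≤ j → j ≤ v → j ≤ u + 1
  v⇒u+1 1            _ _   = subst (1 ≤_) (+-comm 1 u) (s≤s z≤n)
  v⇒u+1 (suc (suc K)) _ K<v = subst (suc (suc K) ≤_) (+-comm 1 u) (s≤s (from (bounds (suc K) (s≤s z≤n)) K<v))

≤⇔≤-of-equal-offsets : ∀ {a b b′ c d d′} → a + b ≡ c + d → a + b′ ≡ c + d′ → (b ≤ b′) ⇔ (d ≤ d′)
≤⇔≤-of-equal-offsets {a} {b} {b′} {c} {d} {d′} eq eq′ = mk⇔
  (λ b≤b′ → +-cancelˡ-≤ c d d′ (subst₂ _≤_ eq eq′ (+-monoʳ-≤ a b≤b′)))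
  (λ d≤d′ → +-cancelˡ-≤ a b b′ (subst₂ _≤_ (sym eq) (sym eq′) (+-monoʳ-≤ c d≤d′)))

≤conj⇔≤part : ∀ {λ′} → IsPartition λ′ → ∀ i K → 1 ≤ i → 1 ≤ K → (K ≤ conj λ′ i) ⇔ (i ≤ part λ′ (K ∸ 1))
≤conj⇔≤part {λ′} (_ , anti) i (suc k) 1≤i _ = <conj⇔≤part λ′ anti i k 1≤i

module OrthogonalBeta {m : ℕ} {λ′ : List ℕ} (λ′-bdd : BoundedPartition m λ′) where
  open BoundedPartition λ′-bdd
  open BetaSet λ′-bdd

  ≤part⇔≤count≥ : ∀ i K p → 1 ≤ i → 1 ≤ K → p + K ≡ i + m → (i ≤ part λ′ (K ∸ 1)) ⇔ (K ≤ count≥ p)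
  ≤part⇔≤count≥ i (suc k) p 1≤i _ p+K≡ = mk⇔
    (λ i≤part → let k<m = k<m-of i≤part in
       from (<count≥⇔ p k) (k<m , +-cancelʳ-≤ (suc k) p (x k)
         (subst₂ _≤_ (sym p+K≡) (sym (β+index λ′ m k k<m)) (+-monoˡ-≤ m i≤part))))
    (λ k<count → let (k<m , p≤xk) = to (<count≥⇔ p k) k<count in
       +-cancelʳ-≤ m i (part λ′ k) (subst₂ _≤_ p+K≡ (β+index λ′ m k k<m) (+-monoˡ-≤ (suc k) p≤xk)))
    where
    k<m-of : i ≤ part λ′ k → k < m
    k<m-of i≤part with k <? m
    ... | yes k<m = k<m
    ... | no  k≮m = contradiction (≤-trans i≤part (≤-reflexive (part-beyond k (≮⇒≥ k≮m)))) (<⇒≱ 1≤i)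

  ≤rank⇔≤count≥m : ∀ i → 1 ≤ i → (i ≤ rank λ′) ⇔ (i ≤ count≥ m)
  ≤rank⇔≤count≥m i 1≤i = ≤part⇔≤count≥ i i m 1≤i 1≤i (+-comm m i) ⇔-∘ ≤rank⇔≤part λ′ isPartition i 1≤i

  -- Orthogonality conj λ′ i + 1 = λ_i (i ≤ rank), stated through lower bounds: K ≤ conj λ′ i iff i ≤ λ_K.
  ShiftedConjugate : Set
  ShiftedConjugate = ∀ i → 1 ≤ i → i ≤ count≥ m → ∀ K → 1 ≤ K → (i ≤ part λ′ (K ∸ 1)) ⇔ (suc K ≤ part λ′ (i ∸ 1))

  orthogonal⇒shiftedConjugate : Orthogonal λ′ → ShiftedConjugate
  orthogonal⇒shiftedConjugate orth i 1≤i i≤count K 1≤K =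
    +1≡⇒≤⇔suc≤ (orth i 1≤i (from (≤rank⇔≤count≥m i 1≤i) i≤count)) K ⇔-∘ ⇔-sym (≤conj⇔≤part isPartition i K 1≤i 1≤K)

  shiftedConjugate⇒orthogonal : ShiftedConjugate → Orthogonal λ′
  shiftedConjugate⇒orthogonal shifted i 1≤i i≤rank =
    ≤⇔suc≤⇒+1≡ (≤-trans 1≤i (to (≤rank⇔≤part λ′ isPartition i 1≤i) i≤rank))
      (λ K 1≤K → shifted i 1≤i (to (≤rank⇔≤count≥m i 1≤i) i≤rank) K 1≤K ⇔-∘ ≤conj⇔≤part isPartition i K 1≤i 1≤K)

  Balanced : Set
  Balanced = ∀ p d → p + d ≡ m → p + count≥ p ≡ m + count≥ (m + suc d)

  shiftedConjugate⇒balanced : ShiftedConjugate → Balanced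
  shiftedConjugate⇒balanced shifted p d p+d≡m = trans (sym m+G≡) (cong (m +_) G≡count≥q)
    where
    q = m + suc d
    G = p + count≥ p ∸ m
    m+G≡ : m + G ≡ p + count≥ p
    m+G≡ = m+[n∸m]≡n (subst₂ _≤_ count≥-zero (+-comm (count≥ p) p) (count≥-lipschitz 0 p))
    G≤count≥m : G ≤ count≥ m
    G≤count≥m = +-cancelˡ-≤ m G (count≥ m) (begin
      m + G                      ≡⟨ m+G≡ ⟩
      p + count≥ p               ≤⟨ +-monoʳ-≤ p (count≥-lipschitz p d) ⟩
      p + (count≥ (p + d) + d)   ≡⟨ cong (λ k → p + (count≥ k + d)) p+d≡m ⟩
      p + (count≥ m + d)         ≡⟨ trans (sym (+-assoc p _ d)) (trans (+-right-comm p (count≥ m) d) (cong (_+ count≥ m) p+d≡m)) ⟩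
      m + count≥ m               ∎)
      where open ≤-Reasoning
    bounds : ∀ i → 1 ≤ i → i ≤ count≥ m → (i ≤ G) ⇔ (i ≤ count≥ q)
    bounds i 1≤i i≤count =
      ≤part⇔≤count≥ (suc K) i q (s≤s z≤n) 1≤i (q+i≡ m d i)
        ⇔-∘ (shifted i 1≤i i≤count K (≤-trans 1≤i (m≤m+n i d))
        ⇔-∘ (⇔-sym (≤part⇔≤count≥ i K p 1≤i (≤-trans 1≤i (m≤m+n i d)) (trans p+K≡m+i (+-comm m i)))
        ⇔-∘ ≤⇔≤-of-equal-offsets (sym p+K≡m+i) m+G≡))
      where
      K = i + d
      p+K≡m+i : p + K ≡ m + i
      p+K≡m+i = trans (trans (sym (+-assoc p i d)) (+-right-comm p i d)) (cong (_+ i) p+d≡m)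
      q+i≡ : ∀ m d i → m + suc d + i ≡ suc (i + d) + m
      q+i≡ = solve-∀
    G≡count≥q : G ≡ count≥ q
    G≡count≥q = ≡-by-positive-lower-bounds G (count≥ q)
      (λ i 1≤i i≤G → to (bounds i 1≤i (≤-trans i≤G G≤count≥m)) i≤G)
      (λ i 1≤i i≤cq → from (bounds i 1≤i (≤-trans i≤cq (count≥-antitone (m≤m+n m (suc d))))) i≤cq)

  balanced⇒count≥2m+1≡0 : Balanced → count≥ (m + suc m) ≡ 0
  balanced⇒count≥2m+1≡0 balanced = +-cancelˡ-≡ m _ _ (trans (sym (balanced 0 m refl)) (trans count≥-zero (sym (+-identityʳ m))))

  module FromBalanced (balanced : Balanced) where

    bounds-far : ∀ {i K q} → 1 ≤ i → i + m < K → q + i ≡ suc K + m → (i ≤ part λ′ (K ∸ 1)) ⇔ (i ≤ count≥ q)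
    bounds-far {i} {K} {q} 1≤i i+m<K q+i≡ = mk⇔
      (λ i≤part → contradiction (≤-trans i≤part (≤-reflexive part≡0)) (<⇒≱ 1≤i))
      (λ i≤count → contradiction (≤-trans i≤count (≤-trans (count≥-antitone 2m+1≤q)
                     (≤-reflexive (balanced⇒count≥2m+1≡0 balanced)))) (<⇒≱ 1≤i))
      where
      part≡0 : part λ′ (K ∸ 1) ≡ 0
      part≡0 = part-beyond (K ∸ 1) (≤-trans (m≤n+m m i) (∸-monoˡ-≤ 1 i+m<K))
      2m+1≤q : m + suc m ≤ q
      2m+1≤q = +-cancelʳ-≤ i _ _ (begin
        m + suc m + i   ≡⟨ reorder m i ⟩
        suc (i + m) + m ≤⟨ +-monoˡ-≤ m i+m<K ⟩
        K + m           ≤⟨ n≤1+n _ ⟩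
        suc K + m       ≡⟨ sym q+i≡ ⟩
        q + i           ∎)
        where
        open ≤-Reasoning
        reorder : ∀ m i → m + suc m + i ≡ suc (i + m) + m
        reorder = solve-∀

    bounds-near-below : ∀ {i K p q} → i ≤ K → p + K ≡ i + m → q + i ≡ suc K + m → (K ≤ count≥ p) ⇔ (i ≤ count≥ q)
    bounds-near-below {i} {K} {p} {q} i≤K p+K≡ q+i≡ =
      ≤⇔≤-of-equal-offsets (trans p+K≡ (+-comm i m)) (trans (balanced p d p+d≡m) (cong (λ k → m + count≥ k) q≡))
      where
      d = K ∸ i
      i+d≡K : i + d ≡ K
      i+d≡K = m+[n∸m]≡n i≤K
      p+d≡m : p + d ≡ m
      p+d≡m = +-cancelˡ-≡ i _ _ (begin
        i + (p + d)   ≡⟨ trans (sym (+-assoc i p d)) (trans (cong (_+ d) (+-comm i p)) (+-assoc p i d)) ⟩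
        p + (i + d)   ≡⟨ cong (p +_) i+d≡K ⟩
        p + K         ≡⟨ p+K≡ ⟩
        i + m         ∎)
        where open ≡-Reasoning
      q≡ : m + suc d ≡ q
      q≡ = +-cancelʳ-≡ i _ _ (begin
        m + suc d + i    ≡⟨ reorder m d i ⟩
        suc (i + d) + m  ≡⟨ cong (λ k → suc k + m) i+d≡K ⟩
        suc K + m        ≡⟨ sym q+i≡ ⟩
        q + i            ∎)
        where
        open ≡-Reasoning
        reorder : ∀ m d i → m + suc d + i ≡ suc (i + d) + m
        reorder = solve-∀

    bounds-near-above : ∀ {i K p q} → i ≤ count≥ m → K < i → p + K ≡ i + m → q + i ≡ suc K + m →
      (K ≤ count≥ p) ⇔ (i ≤ count≥ q)
    bounds-near-above {i} {K} {p} {q} i≤count K<i p+K≡ q+i≡ = mk⇔ (λ _ → i≤count≥q) (λ _ → K≤count≥p)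
      where
      i≤count≥q : i ≤ count≥ q
      i≤count≥q = ≤-trans i≤count (count≥-antitone (+-cancelʳ-≤ i q m
        (subst (_≤ m + i) (sym q+i≡) (subst (suc K + m ≤_) (+-comm i m) (+-monoˡ-≤ m K<i)))))
      e = i ∸ K
      K+e≡i : K + e ≡ i
      K+e≡i = m+[n∸m]≡n (<⇒≤ K<i)
      m+e≡p : m + e ≡ p
      m+e≡p = +-cancelʳ-≡ K _ _ (begin
        m + e + K   ≡⟨ trans (+-assoc m e K) (cong (m +_) (trans (+-comm e K) K+e≡i)) ⟩
        m + i       ≡⟨ trans (+-comm m i) (sym p+K≡) ⟩
        p + K       ∎)
        where open ≡-Reasoning
      K≤count≥p : K ≤ count≥ p
      K≤count≥p = +-cancelʳ-≤ e K (count≥ p) (begin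
        K + e              ≡⟨ K+e≡i ⟩
        i                  ≤⟨ i≤count ⟩
        count≥ m           ≤⟨ count≥-lipschitz m e ⟩
        count≥ (m + e) + e ≡⟨ cong (λ k → count≥ k + e) m+e≡p ⟩
        count≥ p + e       ∎)
        where open ≤-Reasoning

  balanced⇒shiftedConjugate : Balanced → ShiftedConjugate
  balanced⇒shiftedConjugate balanced i 1≤i i≤count K 1≤K =
    ⇔-sym (≤part⇔≤count≥ (suc K) i q (s≤s z≤n) 1≤i q+i≡) ⇔-∘ ≤part⇔≤count≥q
    where
    open FromBalanced balanced
    q = suc K + m ∸ i
    q+i≡ : q + i ≡ suc K + m
    q+i≡ = m∸n+n≡m (≤-trans (≤-trans i≤count (count≥≤m m)) (m≤n+m m (suc K)))
    ≤part⇔≤count≥q : (i ≤ part λ′ (K ∸ 1)) ⇔ (i ≤ count≥ q)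
    ≤part⇔≤count≥q with K ≤? i + m | i ≤? K
    ... | no  K≰i+m | _       = bounds-far 1≤i (≰⇒> K≰i+m) q+i≡
    ... | yes K≤i+m | yes i≤K = bounds-near-below i≤K p+K≡ q+i≡ ⇔-∘ ≤part⇔≤count≥ i K p 1≤i 1≤K p+K≡
      where
      p = i + m ∸ K
      p+K≡ = m∸n+n≡m K≤i+m
    ... | yes K≤i+m | no  i≰K = bounds-near-above i≤count (≰⇒> i≰K) p+K≡ q+i≡ ⇔-∘ ≤part⇔≤count≥ i K p 1≤i 1≤K p+K≡
      where
      p = i + m ∸ K
      p+K≡ = m∸n+n≡m K≤i+m

  -- The β-set lies below 2m + 1, avoids m, and contains exactly one of p and 2m − p for each p < m.
  Symmetric : Set
  Symmetric = count≥ (m + suc m) ≡ 0 × count≡ m ≡ 0 ×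
              (∀ p d → p + suc d ≡ m → count≡ p + count≡ (m + suc d) ≡ 1)

  private
    +≡1⇔suc≡ : ∀ Z W a b → Z + a ≡ W → (a + b ≡ 1) ⇔ (suc Z ≡ W + b)
    +≡1⇔suc≡ Z W a b Z+a≡W = mk⇔
      (λ a+b≡1 → trans (+-comm 1 Z) (trans (cong (Z +_) (sym a+b≡1)) (trans (sym (+-assoc Z a b)) (cong (_+ b) Z+a≡W))))
      (λ 1+Z≡ → +-cancelˡ-≡ Z _ _ (trans (sym (+-assoc Z a b)) (trans (cong (_+ b) Z+a≡W) (trans (sym 1+Z≡) (+-comm 1 Z)))))

    count≥-step-above : ∀ d → count≥ (m + suc d) ≡ count≥ (m + suc (suc d)) + count≡ (m + suc d)
    count≥-step-above d = trans (count≥-step (m + suc d)) (cong (λ k → count≥ k + count≡ (m + suc d)) (sym (+-suc m (suc d))))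

    balance-step : ∀ p d → p + count≥ (suc p) + count≡ p ≡ m + count≥ (m + suc (suc d)) →
      (count≡ p + count≡ (m + suc d) ≡ 1) ⇔ (suc p + count≥ (suc p) ≡ m + count≥ (m + suc d))
    balance-step p d balanced-p = mk⇔
      (λ pair → trans (to step pair) (trans (+-assoc m _ _) (cong (m +_) (sym (count≥-step-above d)))))
      (λ bal → from step (trans bal (trans (cong (m +_) (count≥-step-above d)) (sym (+-assoc m _ _)))))
      where step = +≡1⇔suc≡ (p + count≥ (suc p)) (m + count≥ (m + suc (suc d))) (count≡ p) (count≡ (m + suc d)) balanced-p

  balanced⇒symmetric : Balanced → Symmetric
  balanced⇒symmetric balanced = balanced⇒count≥2m+1≡0 balanced , m∉β , pairs
    where
    m∉β : count≡ m ≡ 0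
    m∉β = +-cancelˡ-≡ (count≥ (suc m)) _ _ (begin
      count≥ (suc m) + count≡ m ≡⟨ sym (count≥-step m) ⟩
      count≥ m                  ≡⟨ +-cancelˡ-≡ m _ _ (trans (balanced m 0 (+-identityʳ m)) (cong (λ k → m + count≥ k) (+-suc m 0))) ⟩
      count≥ (suc (m + 0))      ≡⟨ cong (λ k → count≥ (suc k)) (+-identityʳ m) ⟩
      count≥ (suc m)            ≡⟨ sym (+-identityʳ _) ⟩
      count≥ (suc m) + 0        ∎)
      where open ≡-Reasoning
    pairs : ∀ p d → p + suc d ≡ m → count≡ p + count≡ (m + suc d) ≡ 1
    pairs p d p+1+d≡m = from (balance-step p d balanced-p) (balanced (suc p) d (trans (sym (+-suc p d)) p+1+d≡m))
      where
      balanced-p : p + count≥ (suc p) + count≡ p ≡ m + count≥ (m + suc (suc d))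
      balanced-p = trans (+-assoc p _ _) (trans (cong (p +_) (sym (count≥-step p))) (balanced p (suc d) p+1+d≡m))

  symmetric⇒balanced : Symmetric → Balanced
  symmetric⇒balanced (top , _ , pairs) = go
    where
    go : ∀ p d → p + d ≡ m → p + count≥ p ≡ m + count≥ (m + suc d)
    go zero    d refl = trans count≥-zero (sym (trans (cong (m +_) top) (+-identityʳ m)))
    go (suc p) d 1+p+d≡m = to (balance-step p d balanced-p) (pairs p d p+1+d≡m)
      where
      p+1+d≡m : p + suc d ≡ m
      p+1+d≡m = trans (+-suc p d) 1+p+d≡m
      balanced-p : p + count≥ (suc p) + count≡ p ≡ m + count≥ (m + suc (suc d))
      balanced-p = trans (+-assoc p _ _) (trans (cong (p +_) (sym (count≥-step p))) (go p (suc d) p+1+d≡m))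

  orthogonal⇔symmetric : Orthogonal λ′ ⇔ Symmetric
  orthogonal⇔symmetric = mk⇔
    (λ orth → balanced⇒symmetric (shiftedConjugate⇒balanced (orthogonal⇒shiftedConjugate orth)))
    (λ symmetric → shiftedConjugate⇒orthogonal (balanced⇒shiftedConjugate (symmetric⇒balanced symmetric)))

-- Runners of the abacus

∑-by-values : ∀ (f g : ℕ → ℕ) m V → (∀ l → l < m → f l < V) →
  ∑ (λ l → g (f l)) m ≡ ∑ (λ y → g y * count (λ l → f l ≟ y) m) V
∑-by-values f g zero    V _     = sym (∑-zero V (λ y _ → *-zeroʳ (g y)))
∑-by-values f g (suc m) V f<V = begin
  ∑ (λ l → g (f l)) m + g (f m)
    ≡⟨ cong₂ _+_ (∑-by-values f g m V (λ l l<m → f<V l (m<n⇒m<1+n l<m))) (sym at-f-m) ⟩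
  ∑ (λ y → g y * count (λ l → f l ≟ y) m) V + ∑ (λ y → g y * χ (f m ≟ y)) V
    ≡⟨ sym (∑-+ _ _ V) ⟩
  ∑ (λ y → g y * count (λ l → f l ≟ y) m + g y * χ (f m ≟ y)) V
    ≡⟨ ∑-cong V (λ y _ → sym (*-distribˡ-+ (g y) _ _)) ⟩
  ∑ (λ y → g y * count (λ l → f l ≟ y) (suc m)) V ∎
  where
  open ≡-Reasoning
  at-f-m : ∑ (λ y → g y * χ (f m ≟ y)) V ≡ g (f m)
  at-f-m = trans (∑-single (f m) V (f<V m ≤-refl)
                   (λ y _ y≢fm → trans (cong (g y *_) (χ-no (f m ≟ y) (λ fm≡y → y≢fm (sym fm≡y)))) (*-zeroʳ (g y))))
                 (trans (cong (g (f m) *_) (χ-yes (f m ≟ f m) refl)) (*-identityʳ (g (f m))))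

residueCount : (t : ℕ) .{{_ : NonZero t}} → ℕ → List ℕ → ℕ → ℕ
residueCount t m λ′ r = count (λ l → β λ′ m l % t ≟ r) m

ResidueCondition : ℕ → ℕ → (ℕ → ℕ) → Set
ResidueCondition t n counts = counts 0 ≡ n × (∀ r → 1 ≤ r → r < t → counts r + counts (t ∸ r) ≡ 2 * n)

ResidueCondition-resp : ∀ {t n f g} → (∀ r → f r ≡ g r) → ResidueCondition t n f → ResidueCondition t n g
ResidueCondition-resp {t} f≗g (count0 , pairs) =
  trans (sym (f≗g 0)) count0 , λ r 1≤r r<t → trans (sym (cong₂ _+_ (f≗g r) (f≗g (t ∸ r)))) (pairs r 1≤r r<t)

module Abacus (t : ℕ) .{{_ : NonZero t}} {m : ℕ} {λ′ : List ℕ} (λ′-bdd : BoundedPartition m λ′) where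
  open BetaSet λ′-bdd

  beadsOn : ℕ → ℕ
  beadsOn = residueCount t m λ′

  height : ℕ
  height = suc (x 0)

  x<height : ∀ l → x l < height
  x<height l = s≤s (x-antitone z≤n)

  beadsOn≡∑runner : ∀ r → r < t → beadsOn r ≡ ∑ (λ j → count≡ (r + j * t)) height
  beadsOn≡∑runner r r<t = begin
    beadsOn r
      ≡⟨ ∑-by-values x (λ y → χ (y % t ≟ r)) m (height * t) (λ l _ → <-≤-trans (x<height l) (m≤m*n height t)) ⟩
    ∑ (λ y → χ (y % t ≟ r) * count≡ y) (height * t)
      ≡⟨ ∑-blocks (λ y → χ (y % t ≟ r) * count≡ y) t height ⟩
    ∑ (λ j → ∑ (λ s → χ ((s + j * t) % t ≟ r) * count≡ (s + j * t)) t) height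
      ≡⟨ ∑-cong height (λ j _ → row j) ⟩
    ∑ (λ j → count≡ (r + j * t)) height ∎
    where
    open ≡-Reasoning
    residue : ∀ s j → s < t → (s + j * t) % t ≡ s
    residue s j s<t = trans ([m+kn]%n≡m%n s j t) (m<n⇒m%n≡m s<t)
    row : ∀ j → ∑ (λ s → χ ((s + j * t) % t ≟ r) * count≡ (s + j * t)) t ≡ count≡ (r + j * t)
    row j = trans (∑-single r t r<t (λ s s<t s≢r → cong (_* count≡ (s + j * t))
                    (χ-no ((s + j * t) % t ≟ r) (λ eq → s≢r (trans (sym (residue s j s<t)) eq)))))
                  (trans (cong (_* count≡ (r + j * t)) (χ-yes ((r + j * t) % t ≟ r) (residue r j r<t))) (+-identityʳ _))

  -- On a flush abacus the beads of each runner sit in its top rows.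
  module Flush (flush : IsFlush t m λ′) where
    OnRunner : ℕ → ℕ → Set
    OnRunner r j = count≡ (r + j * t) ≡ 1

    onRunner? : ∀ r j → Dec (OnRunner r j)
    onRunner? r j = count≡ (r + j * t) ≟ 1

    χ-onRunner : ∀ r j → χ (onRunner? r j) ≡ count≡ (r + j * t)
    χ-onRunner r j with count≡-0-or-1 (r + j * t)
    ... | inj₁ ≡0 = trans (χ-no (onRunner? r j) (λ ≡1 → 0≢1+n (trans (sym ≡0) ≡1))) (sym ≡0)
    ... | inj₂ ≡1 = trans (χ-yes (onRunner? r j) ≡1) (sym ≡1)

    onRunner-closed : ∀ r j → OnRunner r (suc j) → OnRunner r j
    onRunner-closed r j bead with to (count≡-positive⇔IsBeta _) (≤-reflexive (sym bead))
    ... | l , l<m , xl≡ = ≤-antisym (count≡≤1 _) (from (count≡-positive⇔IsBeta _) (subst (IsBeta m λ′) slide (flush l l<m t≤xl)))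
      where
      t≤xl : t ≤ x l
      t≤xl = subst (t ≤_) (sym xl≡) (≤-trans (m≤m+n t (j * t)) (m≤n+m (t + j * t) r))
      slide : x l ∸ t ≡ r + j * t
      slide = trans (cong (_∸ t) (trans xl≡ (reorder r j t))) (m+n∸n≡m (r + j * t) t)
        where
        reorder : ∀ r j t → r + suc j * t ≡ r + j * t + t
        reorder = solve-∀

    onRunner⇒<height : ∀ r j → OnRunner r j → j < height
    onRunner⇒<height r j bead with to (count≡-positive⇔IsBeta _) (≤-reflexive (sym bead))
    ... | l , _ , xl≡ = ≤-<-trans (≤-trans (m≤m*n j t) (subst (j * t ≤_) (sym xl≡) (m≤n+m (j * t) r))) (x<height l)

    onRunner⇔<beadsOn : ∀ r → r < t → ∀ j → OnRunner r j ⇔ (j < beadsOn r)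
    onRunner⇔<beadsOn r r<t j = mk⇔
      (λ bead → subst (j <_) (sym beadsOn≡) (from (runner j) (onRunner⇒<height r j bead , bead)))
      (λ j<count → proj₂ (to (runner j) (subst (j <_) beadsOn≡ j<count)))
      where
      beadsOn≡ : beadsOn r ≡ count (onRunner? r) height
      beadsOn≡ = trans (beadsOn≡∑runner r r<t) (∑-cong height (λ j _ → sym (χ-onRunner r j)))
      runner = DownClosed.<count⇔ (onRunner? r) (onRunner-closed r) height

-- Residue counts of symmetric flush β-sets

complementary-prefixes : ∀ N a b (f g : ℕ → ℕ) → (∀ j → f j ≡ 0 ⊎ f j ≡ 1) →
  (∀ j → (f j ≡ 1) ⇔ (j < a)) → (∀ j → (g j ≡ 1) ⇔ (j < b)) → a ≤ N → b ≤ N →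
  (∀ j j′ → j + suc j′ ≡ N → f j + g j′ ≡ 1) → a + b ≡ N
complementary-prefixes N a b f g f01 f⇔ g⇔ a≤N b≤N exactly-one =
  ≤-antisym (subst (a + b ≤_) a+o≡N (+-monoʳ-≤ a b≤o)) N≤a+b
  where
  o = N ∸ a
  a+o≡N : a + o ≡ N
  a+o≡N = m+[n∸m]≡n a≤N
  b≤o : b ≤ o
  b≤o with 1 ≤? a
  ... | no  1≰a = subst (λ k → b ≤ N ∸ k) (sym (n<1⇒n≡0 (≰⇒> 1≰a))) b≤N
  ... | yes 1≤a = ≮⇒≥ λ o<b → contradiction (exactly-one a′ o (trans (+-suc a′ o) (subst (λ k → k + o ≡ N) (sym 1+a′≡a) a+o≡N)))
                    (λ sum≡1 → 1+n≢n {1} (subst (_≡ 1) (cong₂ _+_ (from (f⇔ a′) (subst (a′ <_) 1+a′≡a ≤-refl)) (from (g⇔ o) o<b)) sum≡1))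
    where
    a′ = a ∸ 1
    1+a′≡a : suc a′ ≡ a
    1+a′≡a = trans (+-comm 1 a′) (m∸n+n≡m 1≤a)
  N≤a+b : N ≤ a + b
  N≤a+b with m≤n⇒m<n∨m≡n a≤N
  ... | inj₂ a≡N = subst (_≤ a + b) a≡N (m≤m+n a b)
  ... | inj₁ a<N = subst (_≤ a + b) (trans (+-suc a o′) a+1+o′≡N) (+-monoʳ-≤ a (to (g⇔ o′) g≡1))
    where
    o′ = N ∸ suc a
    a+1+o′≡N : suc a + o′ ≡ N
    a+1+o′≡N = m+[n∸m]≡n a<N
    f≡0 : f a ≡ 0
    f≡0 with f01 a
    ... | inj₁ ≡0 = ≡0
    ... | inj₂ ≡1 = contradiction (to (f⇔ a) ≡1) (<-irrefl refl)
    g≡1 : g o′ ≡ 1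
    g≡1 = trans (sym (cong (_+ g o′) f≡0)) (exactly-one a o′ (trans (+-suc a o′) a+1+o′≡N))

module ResidueBalance (t n : ℕ) .{{_ : NonZero t}} {κ : List ℕ} (κ-bdd : BoundedPartition (t * n) κ)
  (flush : IsFlush t (t * n) κ) where
  open BetaSet κ-bdd
  open OrthogonalBeta κ-bdd
  open Abacus t κ-bdd
  open Flush flush

  private
    m : ℕ
    m = t * n

  bead : ℕ → ℕ → ℕ
  bead r j = count≡ (r + j * t)

  bead≡1 : ∀ {r j} → r < t → j < beadsOn r → bead r j ≡ 1
  bead≡1 {r} {j} r<t = from (onRunner⇔<beadsOn r r<t j)

  bead≡0 : ∀ {r j} → r < t → ¬ j < beadsOn r → bead r j ≡ 0
  bead≡0 {r} {j} r<t j≮count with count≡-0-or-1 (r + j * t)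
  ... | inj₁ ≡0 = ≡0
  ... | inj₂ ≡1 = contradiction (to (onRunner⇔<beadsOn r r<t j) ≡1) j≮count

  bead≡1⇒< : ∀ {r j} → r < t → bead r j ≡ 1 → j < beadsOn r
  bead≡1⇒< {r} {j} r<t = to (onRunner⇔<beadsOn r r<t j)

  m≡0+n*t : m ≡ 0 + n * t
  m≡0+n*t = *-comm t n

  m+m≡2n*t : m + m ≡ 2 * n * t
  m+m≡2n*t = rearrange t n
    where
    rearrange : ∀ t n → t * n + t * n ≡ 2 * n * t
    rearrange = solve-∀

  row<m : ∀ {r j} → r < t → j < n → r + j * t < m
  row<m {r} {j} r<t j<n = begin-strict
    r + j * t  <⟨ +-monoˡ-< (j * t) r<t ⟩
    suc j * t  ≤⟨ *-monoˡ-≤ t j<n ⟩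
    n * t      ≡⟨ *-comm n t ⟩
    m          ∎
    where open ≤-Reasoning

  row-of-<2m+1 : ∀ {r j} → r < t → j < 2 * n → r + j * t < m + suc m
  row-of-<2m+1 {r} {j} r<t j<2n = begin-strict
    r + j * t     <⟨ +-monoˡ-< (j * t) r<t ⟩
    suc j * t     ≤⟨ *-monoˡ-≤ t j<2n ⟩
    2 * n * t     ≡⟨ sym m+m≡2n*t ⟩
    m + m         <⟨ +-monoʳ-< m (n<1+n m) ⟩
    m + suc m     ∎
    where open ≤-Reasoning

  mirror : ∀ {r r′ j j′} → r + r′ ≡ t → j + suc j′ ≡ 2 * n → r + j * t + (r′ + j′ * t) ≡ m + m
  mirror {r} {r′} {j} {j′} r+r′≡t j+1+j′≡2n = begin
    r + j * t + (r′ + j′ * t)  ≡⟨ rearrange r r′ j j′ t ⟩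
    (r + r′) + (j + j′) * t    ≡⟨ cong (_+ (j + j′) * t) r+r′≡t ⟩
    suc (j + j′) * t           ≡⟨ cong (_* t) (trans (sym (+-suc j j′)) j+1+j′≡2n) ⟩
    2 * n * t                  ≡⟨ sym m+m≡2n*t ⟩
    m + m                      ∎
    where
    open ≡-Reasoning
    rearrange : ∀ r r′ j j′ t → r + j * t + (r′ + j′ * t) ≡ (r + r′) + (j + j′) * t
    rearrange = solve-∀

  mirror₀ : ∀ {j j′} → j + j′ ≡ 2 * n → 0 + j * t + (0 + j′ * t) ≡ m + m
  mirror₀ {j} {j′} j+j′≡2n = trans (sym (*-distribʳ-+ t j j′)) (trans (cong (_* t) j+j′≡2n) (sym m+m≡2n*t))

  module FromSymmetric (symmetric : Symmetric) where
    private
      top   = proj₁ symmetric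
      m∉β   = proj₁ (proj₂ symmetric)
      pairs = proj₂ (proj₂ symmetric)

    count≡-pair : ∀ y z → y + z ≡ m + m → y < m → count≡ y + count≡ z ≡ 1
    count≡-pair y z y+z≡ y<m = subst (λ w → count≡ y + count≡ w ≡ 1) z≡ (pairs y d y+1+d≡m)
      where
      d = m ∸ suc y
      y+1+d≡m : y + suc d ≡ m
      y+1+d≡m = trans (+-suc y d) (m+[n∸m]≡n y<m)
      z≡ : m + suc d ≡ z
      z≡ = +-cancelˡ-≡ y _ _ (begin
        y + (m + suc d)  ≡⟨ trans (sym (+-assoc y m (suc d))) (trans (+-right-comm y m (suc d)) (+-comm (y + suc d) m)) ⟩
        m + (y + suc d)  ≡⟨ cong (m +_) y+1+d≡m ⟩
        m + m            ≡⟨ sym y+z≡ ⟩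
        y + z            ∎)
        where open ≡-Reasoning

    count≡-high : ∀ y → m + suc m ≤ y → count≡ y ≡ 0
    count≡-high y 2m+1≤y = n≤0⇒n≡0 (begin
      count≡ y                       ≤⟨ m≤n+m (count≡ y) (count≥ (suc y)) ⟩
      count≥ (suc y) + count≡ y      ≡⟨ sym (count≥-step y) ⟩
      count≥ y                       ≤⟨ count≥-antitone 2m+1≤y ⟩
      count≥ (m + suc m)             ≡⟨ top ⟩
      0                              ∎)
      where open ≤-Reasoning

    beadsOn0≡n : beadsOn 0 ≡ n
    beadsOn0≡n = ≤-antisym count≤n n≤count
      where
      count≤n : beadsOn 0 ≤ n
      count≤n = ≮⇒≥ λ n<count → 0≢1+n (trans (sym (trans (sym (cong count≡ m≡0+n*t)) m∉β)) (bead≡1 (>-nonZero⁻¹ t) n<count))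
      n≤count : n ≤ beadsOn 0
      n≤count with 1 ≤? n
      ... | no  1≰n = subst (_≤ beadsOn 0) (sym (n<1⇒n≡0 (≰⇒> 1≰n))) z≤n
      ... | yes 1≤n = subst (_≤ beadsOn 0) 1+n′≡n (bead≡1⇒< (>-nonZero⁻¹ t) bead-n′)
        where
        n′ = n ∸ 1
        1+n′≡n : suc n′ ≡ n
        1+n′≡n = trans (+-comm 1 n′) (m∸n+n≡m 1≤n)
        n′+2+n′≡2n : n′ + suc (suc n′) ≡ 2 * n
        n′+2+n′≡2n = trans (double n′) (cong (2 *_) 1+n′≡n)
          where
          double : ∀ k → k + suc (suc k) ≡ 2 * suc k
          double = solve-∀
        bead-2+n′ : bead 0 (suc (suc n′)) ≡ 0
        bead-2+n′ = bead≡0 (>-nonZero⁻¹ t) (λ lt → <⇒≱ lt (≤-trans count≤n (≤-trans (≤-reflexive (sym 1+n′≡n)) (n≤1+n _))))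
        bead-n′ : bead 0 n′ ≡ 1
        bead-n′ = trans (sym (+-identityʳ _)) (trans (cong (bead 0 n′ +_) (sym bead-2+n′))
                    (count≡-pair _ _ (mirror₀ {n′} {suc (suc n′)} n′+2+n′≡2n) (row<m (>-nonZero⁻¹ t) (subst (n′ <_) 1+n′≡n ≤-refl))))

    beadsOn≤2n : ∀ r → 1 ≤ r → r < t → beadsOn r ≤ 2 * n
    beadsOn≤2n r 1≤r r<t = ≮⇒≥ λ 2n<count → 0≢1+n (trans (sym (count≡-high _ 2m+1≤)) (bead≡1 r<t 2n<count))
      where
      2m+1≤ : m + suc m ≤ r + 2 * n * t
      2m+1≤ = begin
        m + suc m        ≡⟨ +-suc m m ⟩
        suc (m + m)      ≤⟨ +-monoˡ-≤ (m + m) 1≤r ⟩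
        r + (m + m)      ≡⟨ cong (r +_) m+m≡2n*t ⟩
        r + 2 * n * t    ∎
        where open ≤-Reasoning

    beadsOn-pair : ∀ r → 1 ≤ r → r < t → beadsOn r + beadsOn (t ∸ r) ≡ 2 * n
    beadsOn-pair r 1≤r r<t = complementary-prefixes (2 * n) (beadsOn r) (beadsOn r′) (bead r) (bead r′)
      (λ j → count≡-0-or-1 (r + j * t)) (λ j → onRunner⇔<beadsOn r r<t j) (λ j → onRunner⇔<beadsOn r′ r′<t j)
      (beadsOn≤2n r 1≤r r<t) (beadsOn≤2n r′ (m<n⇒0<n∸m r<t) r′<t) exactly-one
      where
      r′ = t ∸ r
      r′<t : r′ < t
      r′<t = ∸-monoʳ-< 1≤r (<⇒≤ r<t)
      r+r′≡t : r + r′ ≡ t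
      r+r′≡t = m+[n∸m]≡n (<⇒≤ r<t)
      exactly-one : ∀ j j′ → j + suc j′ ≡ 2 * n → bead r j + bead r′ j′ ≡ 1
      exactly-one j j′ j+1+j′≡2n with j <? n
      ... | yes j<n = count≡-pair _ _ (mirror {r} {r′} {j} {j′} r+r′≡t j+1+j′≡2n) (row<m r<t j<n)
      ... | no  j≮n = trans (+-comm (bead r j) (bead r′ j′))
                        (count≡-pair _ _ (trans (+-comm (r′ + j′ * t) (r + j * t)) (mirror {r} {r′} {j} {j′} r+r′≡t j+1+j′≡2n)) (row<m r′<t j′<n))
        where
        j′<n : j′ < n
        j′<n = +-cancelˡ-< n j′ n (begin-strict
          n + j′         ≤⟨ +-monoˡ-≤ j′ (≮⇒≥ j≮n) ⟩
          j + j′         <⟨ ≤-reflexive (sym (+-suc j j′)) ⟩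
          j + suc j′     ≡⟨ j+1+j′≡2n ⟩
          n + (n + 0)    ≡⟨ cong (n +_) (+-identityʳ n) ⟩
          n + n          ∎)
          where open ≤-Reasoning

  symmetric⇒residueCondition : Symmetric → ResidueCondition t n beadsOn
  symmetric⇒residueCondition symmetric = beadsOn0≡n , beadsOn-pair
    where open FromSymmetric symmetric

  module FromResidueCondition (condition : ResidueCondition t n beadsOn) where
    private
      count0≡n   = proj₁ condition
      count-pair = proj₂ condition

    beadsOn≤2n : ∀ r → r < t → beadsOn r ≤ 2 * n
    beadsOn≤2n zero    _   = subst (_≤ 2 * n) (sym count0≡n) (m≤m+n n (n + 0))
    beadsOn≤2n (suc r) r<t = subst (beadsOn (suc r) ≤_) (count-pair (suc r) (s≤s z≤n) r<t)
                                    (m≤m+n (beadsOn (suc r)) (beadsOn (t ∸ suc r)))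

    row-decomposition : ∀ y → y ≡ y % t + y / t * t
    row-decomposition y = m≡m%n+[m/n]*n y t

    count≡-high : ∀ y → m + suc m ≤ y → count≡ y ≡ 0
    count≡-high y 2m+1≤y = trans (cong count≡ (row-decomposition y)) (bead≡0 (m%n<n y t)
      (λ row<count → <⇒≱ (row-of-<2m+1 {y % t} {y / t} (m%n<n y t) (<-≤-trans row<count (beadsOn≤2n _ (m%n<n y t))))
                          (subst (m + suc m ≤_) (row-decomposition y) 2m+1≤y)))

    top : count≥ (m + suc m) ≡ 0
    top with count≥ (m + suc m) in count≡
    ... | zero  = refl
    ... | suc _ = ⊥-elim (<⇒≱ (from (count≡-positive⇔IsBeta (x 0)) (0 , 0<m , refl)) (≤-reflexive (count≡-high (x 0) 2m+1≤x0)))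
      where
      above = to (<count≥⇔ (m + suc m) 0) (subst (1 ≤_) (sym count≡) (s≤s z≤n))
      0<m = proj₁ above
      2m+1≤x0 = proj₂ above

    m∉β : count≡ m ≡ 0
    m∉β = trans (cong count≡ m≡0+n*t) (bead≡0 (>-nonZero⁻¹ t) (λ n<count → <-irrefl (sym count0≡n) n<count))

    pair-on-runner0 : ∀ {j j′} → j < n → j + j′ ≡ 2 * n → bead 0 j + bead 0 j′ ≡ 1
    pair-on-runner0 {j} {j′} j<n j+j′≡2n =
      cong₂ _+_ (bead≡1 (>-nonZero⁻¹ t) (subst (j <_) (sym count0≡n) j<n))
                (bead≡0 (>-nonZero⁻¹ t) (λ j′<count → <⇒≱ (subst (j′ <_) count0≡n j′<count) n≤j′))
      where
      n≤j′ : n ≤ j′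
      n≤j′ = +-cancelˡ-≤ j n j′ (≤-trans (+-monoˡ-≤ n (<⇒≤ j<n))
               (≤-reflexive (trans (cong (n +_) (sym (+-identityʳ n))) (sym j+j′≡2n))))

    pair-on-runners : ∀ {r j j′} → 1 ≤ r → r < t → j + suc j′ ≡ 2 * n → bead r j + bead (t ∸ r) j′ ≡ 1
    pair-on-runners {r} {j} {j′} 1≤r r<t j+1+j′≡2n with j <? beadsOn r
    ... | yes j<count = cong₂ _+_ (bead≡1 r<t j<count) (bead≡0 r′<t (λ j′<count′ → <⇒≱ j<count
                          (+-cancelʳ-≤ (suc j′) (beadsOn r) j
                            (≤-trans (+-monoʳ-≤ (beadsOn r) j′<count′) (≤-reflexive (trans counts (sym j+1+j′≡2n)))))))
      where
      r′<t = ∸-monoʳ-< 1≤r (<⇒≤ r<t)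
      counts = count-pair r 1≤r r<t
    ... | no  j≮count = cong₂ _+_ (bead≡0 r<t j≮count) (bead≡1 r′<t (+-cancelˡ-< (beadsOn r) j′ (beadsOn (t ∸ r)) (begin-strict
                          beadsOn r + j′              ≤⟨ +-monoˡ-≤ j′ (≮⇒≥ j≮count) ⟩
                          j + j′                      <⟨ ≤-reflexive (sym (+-suc j j′)) ⟩
                          j + suc j′                  ≡⟨ j+1+j′≡2n ⟩
                          2 * n                       ≡⟨ sym (count-pair r 1≤r r<t) ⟩
                          beadsOn r + beadsOn (t ∸ r) ∎)))
      where
      open ≤-Reasoning
      r′<t = ∸-monoʳ-< 1≤r (<⇒≤ r<t)

    -- p = r + j t with j < n, and its mirror image 2m − p sits in row 2n − 1 − j of the runner t − r.
    pairs : ∀ p d → p + suc d ≡ m → count≡ p + count≡ (m + suc d) ≡ 1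
    pairs p d p+1+d≡m = trans (cong (λ y → count≡ y + count≡ z) (row-decomposition p)) (by-runner (r ≟ 0))
      where
      r = p % t
      j = p / t
      r<t : r < t
      r<t = m%n<n p t
      z = m + suc d
      j<n : j < n
      j<n = *-cancelʳ-< t j n (begin-strict
        j * t           ≤⟨ m≤n+m (j * t) r ⟩
        r + j * t       ≡⟨ sym (row-decomposition p) ⟩
        p               <⟨ subst (p <_) p+1+d≡m (m<m+n p (s≤s z≤n)) ⟩
        m               ≡⟨ *-comm t n ⟩
        n * t           ∎)
        where open ≤-Reasoning
      z≡ : ∀ {r′ j′} → r + j * t + (r′ + j′ * t) ≡ m + m → z ≡ r′ + j′ * t
      z≡ mirrored = +-cancelˡ-≡ p _ _ (trans p+z≡m+m (trans (sym mirrored) (cong (_+ _) (sym (row-decomposition p)))))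
        where
        p+z≡m+m : p + z ≡ m + m
        p+z≡m+m = trans (sym (+-assoc p m (suc d))) (trans (+-right-comm p m (suc d)) (trans (+-comm (p + suc d) m) (cong (m +_) p+1+d≡m)))
      by-runner : Dec (r ≡ 0) → bead r j + count≡ z ≡ 1
      by-runner (yes r≡0) = subst (λ r → bead r j + count≡ z ≡ 1) (sym r≡0)
        (trans (cong (bead 0 j +_) (cong count≡ (z≡ {0} {j′}
                 (subst (λ r → r + j * t + (0 + j′ * t) ≡ m + m) (sym r≡0) (mirror₀ {j} {j′} j+j′≡2n)))))
               (pair-on-runner0 j<n j+j′≡2n))
        where
        j′ = 2 * n ∸ j
        j+j′≡2n : j + j′ ≡ 2 * n
        j+j′≡2n = m+[n∸m]≡n (≤-trans (<⇒≤ j<n) (m≤m+n n (n + 0)))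
      by-runner (no r≢0) = trans (cong (bead r j +_) (cong count≡ (z≡ {t ∸ r} {j′}
                               (mirror {r} {t ∸ r} {j} {j′} (m+[n∸m]≡n (<⇒≤ r<t)) j+1+j′≡2n))))
                                 (pair-on-runners (n≢0⇒n>0 r≢0) r<t j+1+j′≡2n)
        where
        j′ = 2 * n ∸ suc j
        j+1+j′≡2n : j + suc j′ ≡ 2 * n
        j+1+j′≡2n = trans (+-suc j j′) (m+[n∸m]≡n (≤-trans j<n (m≤m+n n (n + 0))))

  residueCondition⇒symmetric : ResidueCondition t n beadsOn → Symmetric
  residueCondition⇒symmetric condition = top , m∉β , pairs
    where open FromResidueCondition condition

residueCount-reduction-invariant : ∀ t .{{_ : NonZero t}} {m λ′ κ} → BoundedPartition m λ′ → ReducesTo t λ′ κ →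
  ∀ r → residueCount t m κ r ≡ residueCount t m λ′ r
residueCount-reduction-invariant t λ′-bdd reduction r =
  proj₂ (reduction-invariant λ′-bdd reduction) (λ y → χ (y % t ≟ r)) (λ y → cong (λ k → χ (k ≟ r)) ([m+n]%n≡m%n y t))

orthogonalCore⇔residueCondition : ∀ t n .{{_ : NonZero t}} {λ′} → BoundedPartition (t * n) λ′ →
  (∃[ κ ] (TCoreOf t λ′ κ × Orthogonal κ)) ⇔ ResidueCondition t n (residueCount t (t * n) λ′)
orthogonalCore⇔residueCondition t n {λ′} λ′-bdd = mk⇔ to′ from′
  where
  1≤t = >-nonZero⁻¹ t
  to′ : ∃[ κ ] (TCoreOf t λ′ κ × Orthogonal κ) → ResidueCondition t n (residueCount t (t * n) λ′)
  to′ (κ , (reduction , core) , orth) = ResidueCondition-resp (residueCount-reduction-invariant t λ′-bdd reduction)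
    (symmetric⇒residueCondition (to orthogonal⇔symmetric orth))
    where
    κ-bdd = proj₁ (reduction-invariant λ′-bdd reduction)
    open OrthogonalBeta κ-bdd
    open ResidueBalance t n κ-bdd (core⇒flush 1≤t κ-bdd core)
  from′ : ResidueCondition t n (residueCount t (t * n) λ′) → ∃[ κ ] (TCoreOf t λ′ κ × Orthogonal κ)
  from′ condition with reduce-to-flush 1≤t λ′-bdd
  ... | κ , reduction , κ-bdd , flush = κ , (reduction , flush⇒core 1≤t κ-bdd flush) ,
    from orthogonal⇔symmetric (residueCondition⇒symmetric
      (ResidueCondition-resp (λ r → sym (residueCount-reduction-invariant t λ′-bdd reduction r)) condition))
    where
    open OrthogonalBeta κ-bdd
    open ResidueBalance t n κ-bdd flush

nres≡residueCount : ∀ t .{{_ : NonZero t}} λ′ m r → nres t λ′ m r ≡ residueCount t m λ′ r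
nres≡residueCount t λ′ m r =
  trans (cong (λ bs → length (filter (λ b → b % t ≟ r) bs)) (sym (map-∘ (upTo m))))
        (length-filter-map-upTo (λ b → b % t ≟ r) (λ i → β λ′ m i) m)

pairs-up-to-half⇔all-pairs : ∀ t .{{_ : NonZero t}} (f : ℕ → ℕ) c →
  (∀ i → 1 ≤ i → i ≤ t / 2 → f i + f (t ∸ i) ≡ c) ⇔ (∀ r → 1 ≤ r → r < t → f r + f (t ∸ r) ≡ c)
pairs-up-to-half⇔all-pairs t f c = mk⇔ all-pairs (λ pairs i 1≤i i≤half → pairs i 1≤i (≤-<-trans i≤half half<t))
  where
  half = t / 2
  half<t : half < t
  half<t = m/n<m t 2 (s≤s (s≤s z≤n))
  t≤half+1+half : t ≤ half + suc half
  t≤half+1+half = begin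
    t                 ≡⟨ m≡m%n+[m/n]*n t 2 ⟩
    t % 2 + half * 2  ≤⟨ +-monoˡ-≤ (half * 2) (≤-pred (m%n<n t 2)) ⟩
    1 + half * 2      ≡⟨ rearrange half ⟩
    half + suc half   ∎
    where
    open ≤-Reasoning
    rearrange : ∀ h → 1 + h * 2 ≡ h + suc h
    rearrange = solve-∀
  all-pairs : (∀ i → 1 ≤ i → i ≤ half → f i + f (t ∸ i) ≡ c) → ∀ r → 1 ≤ r → r < t → f r + f (t ∸ r) ≡ c
  all-pairs pairs r 1≤r r<t with r ≤? half
  ... | yes r≤half = pairs r 1≤r r≤half
  ... | no  r≰half = trans (+-comm (f r) (f (t ∸ r)))
                       (subst (λ k → f (t ∸ r) + f k ≡ c) (m∸[m∸n]≡n (<⇒≤ r<t)) (pairs (t ∸ r) (m<n⇒0<n∸m r<t) t∸r≤half))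
    where
    t∸r≤half : t ∸ r ≤ half
    t∸r≤half = +-cancelʳ-≤ r (t ∸ r) half (begin
      t ∸ r + r        ≡⟨ m∸n+n≡m (<⇒≤ r<t) ⟩
      t                ≤⟨ t≤half+1+half ⟩
      half + suc half  ≤⟨ +-monoʳ-≤ half (≰⇒> r≰half) ⟩
      half + r         ∎)
      where open ≤-Reasoning

corollary3p8 : (t n : ℕ) .{{_ : NonZero t}} → 2 ≤ t → 1 ≤ n →
    (λ′ : List ℕ) → IsPartition λ′ → length λ′ ≤ t * n →
    (∃[ κ ] (TCoreOf t λ′ κ × Orthogonal κ))
      ⇔ (nres t λ′ (t * n) 0 ≡ n ×
         (∀ i → 1 ≤ i → i ≤ t / 2 → nres t λ′ (t * n) i + nres t λ′ (t * n) (t ∸ i) ≡ 2 * n))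
corollary3p8 t n _ _ λ′ isP length≤ = ⇔-sym counts⇔residueCondition ⇔-∘ orthogonalCore⇔residueCondition t n λ′-bdd
  where
  λ′-bdd : BoundedPartition (t * n) λ′
  λ′-bdd = record { isPartition = isP ; length≤ = length≤ }
  counts = nres t λ′ (t * n)
  counts≡ : ∀ r → counts r ≡ residueCount t (t * n) λ′ r
  counts≡ = nres≡residueCount t λ′ (t * n)
  counts⇔residueCondition : (counts 0 ≡ n × (∀ i → 1 ≤ i → i ≤ t / 2 → counts i + counts (t ∸ i) ≡ 2 * n))
                              ⇔ ResidueCondition t n (residueCount t (t * n) λ′)
  counts⇔residueCondition = mk⇔
    (λ (count0 , half-pairs) → ResidueCondition-resp counts≡ (count0 , to (pairs-up-to-half⇔all-pairs t counts (2 * n)) half-pairs))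
    (λ condition → let (count0 , pairs) = ResidueCondition-resp (λ r → sym (counts≡ r)) condition
                   in count0 , from (pairs-up-to-half⇔all-pairs t counts (2 * n)) pairs)
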